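{- Let $\Gamma$ be a coloring of $T_{d,k}$, $\Omega$ any $k$-ordering of $T_{d,k}$ and $\mathcal T$ its initial $d$-cell. Then $(T_{d,k},\Gamma,\Omega,\mathcal T)\in\mathscr C_{d,k}$ satisfies the universal property: for every object $(\widetilde Y,\hat\gamma,\hat\omega,\hat{\mathfrak a}_0)\in\mathscr C_{d,k}$ there exists a unique morphism $(T_{d,k},\Gamma,\Omega,\mathcal T)\to(\widetilde Y,\hat\gamma,\hat\omega,\hat{\mathfrak a}_0)$.
   Context: Notation: $[n]=\{1,\dots,n\}$, $[\![n]\!]=\{0,\dots,n\}$, $C_k$ cyclic of order $k$, $\mathcal S_B$ symmetric group on $B$. Arboreal complex $T_{d,k}$ ($d,k\ge1$): let $B_0$ consist of a single $d$-cell $\mathcal T$ and its faces; $B_{n+1}$ is obtained from $B_n$ by attaching, to every $(d-1)$-cell of $B_n$ contained in exactly one $d$-cell of $B_n$, $k-1$ new $d$-cells, each using a new vertex; $T_{d,k}=\bigcup_nB_n$. It is colorable; a coloring is a map $\Gamma:T_{d,k}^0\to[\![d]\!]$ injective on each $d$-cell. Multicomplexes. A simplicial complex $X$: nonempty family of finite subsets of a countable vertex set closed under inclusion; $\partial\tau=\{\tau\setminus\{v\}:v\in\tau\}$. A $d$-multicomplex $\widetilde X=(X,\mathsf m,\mathsf g)$: $X$ a $d$-dimensional complex, $\mathsf m:X\to\mathbb N$ ($\mathsf m(\sigma)=1$ if $\dim\sigma\le0$), multicells $(\sigma,r)$, $r\in[\mathsf m(\sigma)]$, $\iota(\sigma,r)=\sigma$,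 gluing $\mathsf g(\mathfrak a,\sigma)=(\sigma,s)$ for $\mathfrak a=(\tau,r)$, $\sigma\in\partial\tau$; $\partial^m\mathfrak a=\{\mathsf g(\mathfrak a,\sigma)\}$, containment = reflexive-transitive closure of $\mathfrak b\in\partial^m\mathfrak a$; consistency: equal-dimensional $\mathfrak b=(\sigma,s),\mathfrak b'=(\sigma',s')$ inside a common multicell with $\rho=\sigma\cap\sigma'$ of dimension $\dim\sigma-1$ satisfy $\mathsf g(\mathfrak b,\rho)=\mathsf g(\mathfrak b',\rho)$. An ordinary simplicial complex is a multicomplex with $\mathsf m\equiv1$. Pure: each multicell lies in a $d$-multicell; $\delta(\mathfrak a)=\{\mathfrak b:\mathfrak a\in\partial^m\mathfrak b\}$, $\deg\mathfrak a=|\delta(\mathfrak a)|$; $d$-lower path connected: any two $d$-multicells are joined by a sequence of $d$-multicells, consecutive ones containing a common $(d-1)$-multicell. Category. A coloring $\gamma:X^0\to[\![d]\!]$ is injective on $d$-cells, extended to (multi)cells as sets of colors. A $k$-ordering $\omega$ assigns to each $(d-1)$-multicell $\mathfrak b$ a transitive homomorphism $\omega_{\mathfrak b}:C_k\to\mathcal S_{\delta(\mathfrak b)}$. $\mathscr C_{d,k}$: objects $(\widetilde X,\gamma,\omega,\mathfrak a_0)$ with $\widetilde X$ pure, colorable, $d$-lower path connected, $(d-1)$-multicells of degree $\le k$, $\gamma$ a coloring, $\omega$ a $k$-ordering, $\mathfrak a_0$ a $d$-multicell. A morphism to $(\widetilde Y,\hat\gamma,\hat\omega,\hat{\mathfrak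 a}_0)$, $\widetilde Y=(Y,\mathsf m',\mathsf g')$, is a map $\widetilde\varphi$ of multicells lying over a simplicial map $\varphi:X\to Y$ ($\iota\circ\widetilde\varphi=\varphi\circ\iota$) with $\mathsf g'(\widetilde\varphi(\mathfrak a),\varphi(\sigma))=\widetilde\varphi(\mathsf g(\mathfrak a,\sigma))$, $\widetilde\varphi(\mathfrak a_0)=\hat{\mathfrak a}_0$, $\hat\gamma\circ\widetilde\varphi=\gamma$ and $\widetilde\varphi(\omega_{\mathfrak b}(\beta).\mathfrak a)=\hat\omega_{\widetilde\varphi(\mathfrak b)}(\beta).\widetilde\varphi(\mathfrak a)$ for all $(d-1)$-multicells $\mathfrak b$, $\mathfrak a\in\delta(\mathfrak b)$, $\beta\in C_k$. -}

module Defs where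

open import Level using (0ℓ)
open import Data.Nat using (ℕ; zero; suc; _+_; _∸_; _≤_; _<_)
open import Data.Nat.DivMod using (_%_; m%n<n)
open import Data.Fin using (Fin; zero; suc; toℕ; fromℕ<)
open import Data.List using (List; []; _∷_; length; removeAt)
open import Data.List.Membership.Propositional using (_∈_; _∉_)
open import Data.List.Relation.Unary.Linked using (Linked)
open import Data.List.Relation.Unary.Unique.Propositional using (Unique)
open import Data.Product using (Σ; ∃; ∃-syntax; _×_; _,_; proj₁)
open import Data.Sum using (_⊎_)
open import Relation.Binary.PropositionalEquality using (_≡_)
open import Relation.Binary.Construct.Closure.ReflexiveTransitive using (Star)

-- Finite subsets of the countable vertex set ℕ are represented by
-- strictly increasing lists (a canonical representation).

Strict : List ℕ → Set
Strict = Linked _<_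

_⇔_ : Set → Set → Set
A ⇔ B = (A → B) × (B → A)
infix 3 _⇔_

_⊆_ : List ℕ → List ℕ → Set
σ ⊆ τ = ∀ v → v ∈ σ → v ∈ τ

-- the cyclic group C_k = ℤ/kℤ, carried by Fin k, with addition mod k
_⊕_ : ∀ {k} → Fin k → Fin k → Fin k
_⊕_ {suc k} a b = fromℕ< (m%n<n (toℕ a + toℕ b) (suc k))

-- Cells are the lists satisfying 'cell'.
-- m and g are given as total functions; only their values on cells
-- (resp. multicells) matter.  The face σ ∈ ∂τ obtained by deleting the
-- i-th vertex of τ is 'removeAt τ i'; g σ r i is the copy s of that face
-- glued to the multicell (σ , r).

record PreMC : Set₁ where
  field
    cell : List ℕ → Set
    m    : List ℕ → ℕ
    g    : (σ : List ℕ) → Fin (m σ) → (i : Fin (length σ)) → Fin (m (removeAt σ i))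

module _ (X : PreMC) where
  open PreMC X

  -- multicells (σ , r), r ∈ [m(σ)]  (r is 0-based here)
  record MCell : Set where
    constructor mc
    field
      ι   : List ℕ
      idx : Fin (m ι)
  open MCell public

  IsMCell : MCell → Set
  IsMCell a = cell (ι a)

  face : (a : MCell) → Fin (length (ι a)) → MCell
  face a i = mc (removeAt (ι a) i) (g (ι a) (idx a) i)

  _∈∂_ : MCell → MCell → Set
  b ∈∂ a = ∃[ i ] face a i ≡ b

  data _⊑_ : MCell → MCell → Set where
    ⊑-refl : ∀ {a} → a ⊑ a
    ⊑-step : ∀ {b c a} → b ∈∂ c → c ⊑ a → b ⊑ a

  δ : MCell → MCell → Set
  δ b a = IsMCell a × b ∈∂ a

  IsDimMCell : ℕ → MCell → Set
  IsDimMCell n a = IsMCell a × length (ι a) ≡ suc n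

  record IsMulticomplex (d : ℕ) : Set where
    field
      cell-strict   : ∀ {σ} → cell σ → Strict σ
      cell-nonempty : ∃[ σ ] cell σ
      cell-closed   : ∀ {σ τ} → cell τ → Strict σ → σ ⊆ τ → cell σ
      dim-le        : ∀ {σ} → cell σ → length σ ≤ suc d
      dim-attained  : ∃[ σ ] (cell σ × length σ ≡ suc d)
      m-low         : ∀ {σ} → cell σ → length σ ≤ 1 → m σ ≡ 1
      consistent    :
        ∀ (a b b' : MCell) (i : Fin (length (ι b))) (j : Fin (length (ι b'))) →
        IsMCell a → b ⊑ a → b' ⊑ a →
        length (ι b) ≡ length (ι b') →
        -- ρ := removeAt (ι b) i equals ι b ∩ ι b' (so dim ρ = dim σ - 1)
        (∀ v → v ∈ removeAt (ι b) i ⇔ (v ∈ ι b × v ∈ ι b')) →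
        removeAt (ι b) i ≡ removeAt (ι b') j →
        face b i ≡ face b' j

  Pure : ℕ → Set
  Pure d = ∀ b → IsMCell b → ∃[ a ] (IsDimMCell d a × b ⊑ a)

  Adjacent : ℕ → MCell → MCell → Set
  Adjacent d a a' = IsDimMCell d a × IsDimMCell d a' × ∃[ b ] (IsMCell b × b ∈∂ a × b ∈∂ a')

  LowerPathConnected : ℕ → Set
  LowerPathConnected d = ∀ a a' → IsDimMCell d a → IsDimMCell d a' → Star (Adjacent d) a a'

  DegLe : ℕ → MCell → Set
  DegLe k b = ∃[ xs ] (Unique xs × length xs ≤ k × (∀ a → a ∈ xs ⇔ δ b a))

  DegBound : ℕ → ℕ → Set
  DegBound d k = ∀ b → IsDimMCell (d ∸ 1) b → DegLe k b

  IsColoring : (d : ℕ) → (ℕ → Fin (suc d)) → Set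
  IsColoring d γ = ∀ σ → cell σ → length σ ≡ suc d →
                   ∀ u v → u ∈ σ → v ∈ σ → γ u ≡ γ v → u ≡ v

  Colorable : ℕ → Set
  Colorable d = ∃[ γ ] IsColoring d γ

  Colors : ∀ {d} → (ℕ → Fin (suc d)) → MCell → Fin (suc d) → Set
  Colors γ a c = ∃[ v ] (v ∈ ι a × γ v ≡ c)

  -- k-orderings: for each (d-1)-multicell b, ω b : C_k → S_{δ(b)} is a
  -- transitive group homomorphism (ω b β given as a map on multicells,
  -- required to restrict to a permutation of δ(b)).
  record IsKOrdering (d k : ℕ) (ω : MCell → Fin k → MCell → MCell) : Set where
    field
      maps-to : ∀ b → IsDimMCell (d ∸ 1) b → ∀ β a → δ b a → δ b (ω b β a)
      inj     : ∀ b → IsDimMCell (d ∸ 1) b → ∀ β a a' → δ b a → δ b a' →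
                ω b β a ≡ ω b β a' → a ≡ a'
      surj    : ∀ b → IsDimMCell (d ∸ 1) b → ∀ β a' → δ b a' →
                ∃[ a ] (δ b a × ω b β a ≡ a')
      hom     : ∀ b → IsDimMCell (d ∸ 1) b → ∀ β β' a → δ b a →
                ω b (β ⊕ β') a ≡ ω b β (ω b β' a)
      trans   : ∀ b → IsDimMCell (d ∸ 1) b → ∀ a a' → δ b a → δ b a' →
                ∃[ β ] ω b β a ≡ a'

record PreObj (d k : ℕ) : Set₁ where
  field
    X  : PreMC
    γ  : ℕ → Fin (suc d)
    ω  : MCell X → Fin k → MCell X → MCell X
    a₀ : MCell X

record IsObj {d k : ℕ} (O : PreObj d k) : Set where
  open PreObj O
  field
    multicomplex : IsMulticomplex X d
    pure         : Pure X d
    colorable    : Colorable X d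
    connected    : LowerPathConnected X d
    degree       : DegBound X d k
    coloring     : IsColoring X d γ
    ordering     : IsKOrdering X d k ω
    base         : IsDimMCell X d a₀

-- Morphisms.  φ̃ is a map of multicells (it may inspect the proof that its
-- argument is a multicell; all conditions quantify over such proofs).
-- It lies over a simplicial map given by the vertex map φ₀.
record Morphism {d k : ℕ} (O O' : PreObj d k) : Set where
  private
    module O  = PreObj O
    module O' = PreObj O'
    X  = O.X
    Y  = O'.X
  field
    φ₀       : (v : ℕ) → PreMC.cell X (v ∷ []) → ℕ
    φ₀-irr   : ∀ v p q → φ₀ v p ≡ φ₀ v q
    φ₀-simp  : ∀ σ → PreMC.cell X σ →
               ∃[ τ ] (PreMC.cell Y τ ×
                 (∀ w → w ∈ τ ⇔ (∃[ v ] (v ∈ σ × Σ (PreMC.cell X (v ∷ [])) λ p → φ₀ v p ≡ w))))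
    φ        : (a : MCell X) → IsMCell X a → MCell Y
    φ-mcell  : ∀ a p → IsMCell Y (φ a p)
    φ-over   : ∀ a p w → w ∈ ι (φ a p) ⇔
               (∃[ v ] (v ∈ ι a × Σ (PreMC.cell X (v ∷ [])) λ q → φ₀ v q ≡ w))
    φ-glue   : ∀ a p i q j → removeAt (ι (φ a p)) j ≡ ι (φ (face X a i) q) →
               face Y (φ a p) j ≡ φ (face X a i) q
    φ-base   : ∀ p → φ O.a₀ p ≡ O'.a₀
    φ-color  : ∀ a p c → Colors Y O'.γ (φ a p) c ⇔ Colors X O.γ a c
    φ-order  : ∀ b (pb : IsMCell X b) → length (ι b) ≡ d →
               ∀ a (pa : IsMCell X a) → _∈∂_ X b a → ∀ β (q : IsMCell X (O.ω b β a)) →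
               φ (O.ω b β a) q ≡ O'.ω (φ b pb) β (φ a pa)

-- The arboreal complex T_{d,k}, given by its defining filtration
-- B_0 ⊆ B_1 ⊆ ... (any choice of names for the new vertices).

BoundaryCell : ℕ → (List ℕ → Set) → List ℕ → Set
BoundaryCell d C ρ =
  C ρ × length ρ ≡ d ×
  ∃[ τ ] ((C τ × length τ ≡ suc d × ρ ⊆ τ) ×
          (∀ τ' → C τ' → length τ' ≡ suc d → ρ ⊆ τ' → τ' ≡ τ))

record Arboreal (d k : ℕ) : Set₁ where
  field
    B         : ℕ → List ℕ → Set
    𝒯         : List ℕ
    𝒯-strict  : Strict 𝒯
    𝒯-dim     : length 𝒯 ≡ suc d
    B-zero    : ∀ σ → B 0 σ ⇔ (Strict σ × σ ⊆ 𝒯)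
    new       : ℕ → List ℕ → Fin (k ∸ 1) → ℕ
    new-fresh : ∀ n ρ j → BoundaryCell d (B n) ρ → ∀ σ → B n σ → new n ρ j ∉ σ
    new-inj   : ∀ n ρ ρ' j j' → BoundaryCell d (B n) ρ → BoundaryCell d (B n) ρ' →
                new n ρ j ≡ new n ρ' j' → ρ ≡ ρ' × j ≡ j'
    B-suc     : ∀ n σ → B (suc n) σ ⇔
                (B n σ ⊎ ∃[ ρ ] ∃[ j ] (BoundaryCell d (B n) ρ × Strict σ ×
                                        (∀ v → v ∈ σ → v ∈ ρ ⊎ v ≡ new n ρ j)))

TComplex : ∀ {d k} → Arboreal d k → PreMC
TComplex A = record
  { cell = λ σ → ∃[ n ] Arboreal.B A n σ
  ; m    = λ _ → 1
  ; g    = λ _ _ _ → zero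
  }

TObj : ∀ {d k} (A : Arboreal d k) → (ℕ → Fin (suc d)) →
       (MCell (TComplex A) → Fin k → MCell (TComplex A) → MCell (TComplex A)) →
       PreObj d k
TObj A Γ Ω = record
  { X  = TComplex A
  ; γ  = Γ
  ; ω  = Ω
  ; a₀ = mc (Arboreal.𝒯 A) zero
  }

-- Every d-cell of T_{d,k} arises from the initial cell 𝒯 by a unique sequence of attachments,
-- each across a (d-1)-face ρ and labelled by the element of C_k by which Ω moves the old d-cell to
-- the new one.  Replaying the sequence in Y, applying ω̂ at the face of the current image that
-- carries the colours of ρ, defines the image of every d-cell.  As colourings are injective on
-- d-cells, a cell σ can then be sent to the face with colours Γ(σ) of the image of any d-cell
-- containing σ: the d-cells containing σ form a subtree, along which consecutive images share that
-- face, and consistency of Y makes a face independent of the order in which vertices are removed.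
-- Conversely a morphism preserves colours and gluing, so it is determined on faces by its values on
-- d-cells, and on d-cells by induction along their derivations, by compatibility with the orderings.

module Submission where

open import Defs
open import Data.Bool using (Bool; true; false; _∧_)
open import Data.Empty using (⊥-elim)
open import Data.Fin using (Fin; zero; suc)
import Data.Fin as Fin
open import Data.List using (List; []; _∷_; length; removeAt; lookup; allFin; tabulate)
import Data.List as List
open import Data.List.Properties using (length-removeAt; length-removeAt′; length-map; length-tabulate)
open import Data.List.Membership.Propositional using (_∈_; _∉_; find; lose)
open import Data.List.Membership.Propositional.Properties using (∈-lookup; ∈-map⁺; ∈-allFin; ∈-tabulate⁺; ∈-tabulate⁻)
open import Data.List.Relation.Unary.All as All using (All; []; _∷_; all?) renaming (lookup to All-lookup)
open import Data.List.Relation.Unary.All.Properties.Core using (¬All⇒Any¬)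
open import Data.List.Relation.Unary.Any as Any using (Any; here; there; any?)
open import Data.List.Relation.Unary.Any.Properties using (lookup-index)
open import Data.List.Relation.Unary.AllPairs as AllPairs using (AllPairs; []; _∷_)
open import Data.List.Relation.Unary.Unique.Propositional using (Unique)
import Data.List.Relation.Unary.Unique.Propositional.Properties as Uniqueₚ
open import Data.List.Relation.Unary.Linked.Properties using (Linked⇒AllPairs; AllPairs⇒Linked)
open import Data.Maybe using (Maybe; just; nothing)
open import Data.Nat using (ℕ; zero; suc; pred; _∸_; _≤_; _<_; z≤n; s≤s; s≤s⁻¹; _≤?_; _<?_)
open import Data.Nat.Properties
  using (<⇒≢; <-asym; <-trans; <-irrefl; <-≤-trans; ≤-<-trans; ≤-refl; ≤-reflexive; ≤-trans; ≤-antisym; ≤-pred;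
         pred-mono-≤; pred[n]≤n; ≮⇒≥; ≰⇒≥; ≰⇒>; ≤∧≢⇒<; suc-injective; m≤n⇒m<n∨m≡n; m≤n⇒m≤1+n; <-cmp; _≟_)
open import Data.List.Membership.DecPropositional _≟_ using (_∈?_)
open import Data.Product using (Σ; ∃-syntax; _×_; _,_; proj₁; proj₂)
open import Data.Sum using (_⊎_; inj₁; inj₂)
open import Relation.Binary.Construct.Closure.ReflexiveTransitive using (Star; ε; _◅_; _◅◅_; reverse)
open import Relation.Binary.Definitions using (tri<; tri≈; tri>)
open import Relation.Binary.PropositionalEquality
  using (_≡_; _≢_; refl; sym; trans; cong; cong₂; subst; subst₂; module ≡-Reasoning)
open import Relation.Nullary using (Dec; yes; no; does)

private
  variable
    V W : Set

∈-removeAt⁻ : ∀ {v} (xs : List V) i → v ∈ removeAt xs i → v ∈ xs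
∈-removeAt⁻ (x ∷ xs) zero    p         = there p
∈-removeAt⁻ (x ∷ xs) (suc i) (here p)  = here p
∈-removeAt⁻ (x ∷ xs) (suc i) (there p) = there (∈-removeAt⁻ xs i p)

∈-removeAt⁺ : ∀ {v} (xs : List V) i → v ∈ xs → v ≢ lookup xs i → v ∈ removeAt xs i
∈-removeAt⁺ (x ∷ xs) zero    (here p)  v≢x = ⊥-elim (v≢x p)
∈-removeAt⁺ (x ∷ xs) zero    (there p) _   = p
∈-removeAt⁺ (x ∷ xs) (suc i) (here p)  _   = here p
∈-removeAt⁺ (x ∷ xs) (suc i) (there p) v≢  = there (∈-removeAt⁺ xs i p v≢)

∈-removeAt⇒≢lookup : ∀ {v} (xs : List V) i → Unique xs → v ∈ removeAt xs i → v ≢ lookup xs i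
∈-removeAt⇒≢lookup (x ∷ xs) zero    (x∉ ∷ _) p         refl = All-lookup x∉ p refl
∈-removeAt⇒≢lookup (x ∷ xs) (suc i) (x∉ ∷ _) (here refl) eq = All-lookup x∉ (∈-lookup i) eq
∈-removeAt⇒≢lookup (x ∷ xs) (suc i) (_ ∷ u)  (there p) eq  = ∈-removeAt⇒≢lookup xs i u p eq

All-removeAt : ∀ {P : V → Set} (xs : List V) i → All P xs → All P (removeAt xs i)
All-removeAt (x ∷ xs) zero    (_ ∷ ps)  = ps
All-removeAt (x ∷ xs) (suc i) (p ∷ ps)  = p ∷ All-removeAt xs i ps

AllPairs-removeAt : ∀ {R : V → V → Set} (xs : List V) i → AllPairs R xs → AllPairs R (removeAt xs i)
AllPairs-removeAt (x ∷ xs) zero    (_ ∷ ps) = ps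
AllPairs-removeAt (x ∷ xs) (suc i) (p ∷ ps) = All-removeAt xs i p ∷ AllPairs-removeAt xs i ps

∈-removeAt² : ∀ {v} (xs : List V) → Unique xs → ∀ i i′ →
              v ∈ removeAt (removeAt xs i) i′ ⇔ (v ∈ xs × v ≢ lookup xs i × v ≢ lookup (removeAt xs i) i′)
∈-removeAt² xs u i i′ =
  (λ p → let q = ∈-removeAt⁻ (removeAt xs i) i′ p in
         ∈-removeAt⁻ xs i q , ∈-removeAt⇒≢lookup xs i u q
       , ∈-removeAt⇒≢lookup (removeAt xs i) i′ (AllPairs-removeAt xs i u) p)
  , λ (p , v≢y , v≢y′) → ∈-removeAt⁺ (removeAt xs i) i′ (∈-removeAt⁺ xs i p v≢y) v≢y′

lookup-injective : ∀ (xs : List V) → Unique xs → ∀ i j → lookup xs i ≡ lookup xs j → i ≡ j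
lookup-injective (x ∷ xs) u        zero    zero    _ = refl
lookup-injective (x ∷ xs) (x∉ ∷ u) zero    (suc j) e = ⊥-elim (All-lookup x∉ (∈-lookup j) e)
lookup-injective (x ∷ xs) (x∉ ∷ u) (suc i) zero    e = ⊥-elim (All-lookup x∉ (∈-lookup i) (sym e))
lookup-injective (x ∷ xs) (_ ∷ u)  (suc i) (suc j) e = cong suc (lookup-injective xs u i j e)

length-≤-injection : (R : V → W → Set) {ys : List V} (xs : List W) → Unique ys →
                     (∀ y → y ∈ ys → Σ W λ x → x ∈ xs × R y x) →
                     (∀ y y′ x → y ∈ ys → y′ ∈ ys → R y x → R y′ x → y ≡ y′) →
                     length ys ≤ length xs
length-≤-injection R xs [] _ _ = z≤n
length-≤-injection R {y ∷ ys} xs (y∉ ∷ u) total inj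
  with total y (here refl)
... | x , x∈ , Ryx = subst (suc (length ys) ≤_) (sym (length-removeAt′ xs i))
                       (s≤s (length-≤-injection R (removeAt xs i) u total′ inj′))
  where
  i = Any.index x∈
  inj′ : ∀ z z′ x → z ∈ ys → z′ ∈ ys → R z x → R z′ x → z ≡ z′
  inj′ z z′ x p q = inj z z′ x (there p) (there q)
  total′ : ∀ z → z ∈ ys → Σ _ λ x′ → x′ ∈ removeAt xs i × R z x′
  total′ z z∈ with total z (there z∈)
  ... | x′ , x′∈ , Rzx′ = x′ , ∈-removeAt⁺ xs i x′∈ x′≢x , Rzx′
    where
    x′≢x : x′ ≢ lookup xs i
    x′≢x e = All-lookup y∉ z∈ (inj y z x (here refl) (there z∈) Ryx
                                  (subst (R z) (trans e (sym (lookup-index x∈))) Rzx′))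

length-≤-⊆ : ∀ {ys : List V} (xs : List V) → Unique ys → (∀ y → y ∈ ys → y ∈ xs) → length ys ≤ length xs
length-≤-⊆ xs u ys⊆xs = length-≤-injection _≡_ xs u (λ y y∈ → y , ys⊆xs y y∈ , refl)
                          (λ _ _ _ _ _ p q → trans p (sym q))

allFinExcept : ∀ {n} (c : Fin (suc n)) → Σ (List (Fin (suc n))) λ cs → length cs ≡ n × (∀ c′ → c′ ≢ c → c′ ∈ cs)
allFinExcept {n} zero = List.map suc (allFin n) , trans (length-map suc (allFin n)) (length-tabulate _) , spans
  where
  spans : ∀ c′ → c′ ≢ zero → c′ ∈ List.map suc (allFin n)
  spans zero    c′≢0 = ⊥-elim (c′≢0 refl)
  spans (suc c′) _   = ∈-map⁺ suc (∈-allFin c′)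
allFinExcept {suc n} (suc c) with allFinExcept c
... | cs , len , spans = zero ∷ List.map suc cs , cong suc (trans (length-map suc cs) len) , spans′
  where
  spans′ : ∀ c′ → c′ ≢ suc c → c′ ∈ zero ∷ List.map suc cs
  spans′ zero     _   = here refl
  spans′ (suc c′) c′≢ = there (∈-map⁺ suc (spans c′ (λ e → c′≢ (cong suc e))))

injection-onto-Fin : ∀ {n} (f : V → Fin (suc n)) (xs : List V) → Unique xs → length xs ≡ suc n →
                     (∀ u v → u ∈ xs → v ∈ xs → f u ≡ f v → u ≡ v) → ∀ c → Σ V λ y → y ∈ xs × f y ≡ c
injection-onto-Fin f xs u len inj c with any? (λ y → f y Fin.≟ c) xs
... | yes hit = find hit
... | no miss with allFinExcept c
... | cs , len-cs , spans = ⊥-elim (<-irrefl refl (<-≤-trans (≤-reflexive (sym len)) (subst (length xs ≤_) len-cs xs↪cs)))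
  where
  xs↪cs : length xs ≤ length cs
  xs↪cs = length-≤-injection (λ y c′ → f y ≡ c′) cs u
            (λ y y∈ → f y , spans (f y) (λ e → miss (lose y∈ e)) , refl)
            (λ y y′ _ p q e e′ → inj y y′ p q (trans e (sym e′)))

onto-injective : ∀ {n} (f : Fin (suc n) → V) (xs : List V) → Unique xs → length xs ≡ suc n →
                 (∀ y → y ∈ xs → Σ (Fin (suc n)) λ c → f c ≡ y) →
                 (∀ c → f c ∈ xs) → ∀ c c′ → f c ≡ f c′ → c ≡ c′
onto-injective f xs u len onto into c c′ e with c Fin.≟ c′
... | yes c≡c′ = c≡c′
... | no c≢c′ with allFinExcept c′
... | cs , len-cs , spans = ⊥-elim (<-irrefl refl (<-≤-trans (≤-reflexive (sym len)) (subst (length xs ≤_) len-cs xs↪cs)))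
  where
  preimage : ∀ y → y ∈ xs → Σ _ λ c″ → c″ ∈ cs × f c″ ≡ y
  preimage y y∈ with onto y y∈
  ... | c″ , fc″ with c″ Fin.≟ c′
  ... | no c″≢c′ = c″ , spans c″ c″≢c′ , fc″
  ... | yes refl = c , spans c c≢c′ , trans e fc″
  xs↪cs : length xs ≤ length cs
  xs↪cs = length-≤-injection (λ y c″ → f c″ ≡ y) cs u preimage (λ _ _ _ _ _ p q → trans (sym p) q)

Increasing : List ℕ → Set
Increasing = AllPairs _<_

strict⇒increasing : ∀ {σ} → Strict σ → Increasing σ
strict⇒increasing = Linked⇒AllPairs <-trans

increasing⇒strict : ∀ {σ} → Increasing σ → Strict σ
increasing⇒strict = AllPairs⇒Linked

increasing⇒unique : ∀ {σ} → Increasing σ → Unique σ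
increasing⇒unique = AllPairs.map <⇒≢

increasing-ext : ∀ {xs ys} → Increasing xs → Increasing ys →
                 (∀ v → v ∈ xs → v ∈ ys) → (∀ v → v ∈ ys → v ∈ xs) → xs ≡ ys
increasing-ext [] [] _ _ = refl
increasing-ext [] (_ ∷ _) _ ys⊆ with ys⊆ _ (here refl)
... | ()
increasing-ext (_ ∷ _) [] xs⊆ _ with xs⊆ _ (here refl)
... | ()
increasing-ext {x ∷ xs} {y ∷ ys} (x< ∷ inc) (y< ∷ inc′) xs⊆ ys⊆ with x≡y | increasing-ext inc inc′ tail⊆ tail⊇
  where
  x≡y : x ≡ y
  x≡y with xs⊆ x (here refl) | ys⊆ y (here refl)
  ... | here e   | _        = e
  ... | there _  | here e   = sym e
  ... | there x∈ | there y∈ = ⊥-elim (<-asym (All-lookup y< x∈) (All-lookup x< y∈))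
  tail⊆ : ∀ v → v ∈ xs → v ∈ ys
  tail⊆ v v∈ with xs⊆ v (there v∈)
  ... | here e  = ⊥-elim (<⇒≢ (All-lookup x< v∈) (trans x≡y (sym e)))
  ... | there p = p
  tail⊇ : ∀ v → v ∈ ys → v ∈ xs
  tail⊇ v v∈ with ys⊆ v (there v∈)
  ... | here e  = ⊥-elim (<⇒≢ (All-lookup y< v∈) (trans (sym x≡y) (sym e)))
  ... | there p = p
... | refl | refl = refl

∃-lookup∉ : ∀ {ys} xs → Unique ys → length xs < length ys → Σ (Fin (length ys)) λ i → lookup ys i ∉ xs
∃-lookup∉ {ys} xs u shorter with all? (_∈? xs) ys
... | yes ys⊆xs = ⊥-elim (<-irrefl refl (<-≤-trans shorter (length-≤-⊆ xs u (λ y y∈ → All-lookup ys⊆xs y∈))))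
... | no ys⊈xs = first-missing (¬All⇒Any¬ (_∈? xs) ys ys⊈xs)
  where
  first-missing : ∀ {zs} → Any (_∉ xs) zs → Σ (Fin (length zs)) λ i → lookup zs i ∉ xs
  first-missing (here z∉)  = zero , z∉
  first-missing (there p) with first-missing p
  ... | i , z∉ = suc i , z∉

increasing-⊆-length⇒≡ : ∀ {xs ys} → Increasing xs → Increasing ys →
                 (∀ v → v ∈ xs → v ∈ ys) → length ys ≤ length xs → xs ≡ ys
increasing-⊆-length⇒≡ {xs} {ys} inc inc′ xs⊆ys ys≤xs = increasing-ext inc inc′ xs⊆ys ys⊆xs
  where
  ys⊆xs : ∀ v → v ∈ ys → v ∈ xs
  ys⊆xs v v∈ with v ∈? xs
  ... | yes p = p
  ... | no v∉ = ⊥-elim (<-irrefl refl (<-≤-trans xs<ys ys≤xs))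
    where
    i = Any.index v∈
    xs⊆ys-i : ∀ y → y ∈ xs → y ∈ removeAt ys i
    xs⊆ys-i y y∈ = ∈-removeAt⁺ ys i (xs⊆ys y y∈) (λ e → v∉ (subst (_∈ xs) (trans e (sym (lookup-index v∈))) y∈))
    xs<ys : length xs < length ys
    xs<ys = subst (length xs <_) (sym (length-removeAt′ ys i))
              (s≤s (length-≤-⊆ (removeAt ys i) (increasing⇒unique inc) xs⊆ys-i))

codim-one-face : ∀ {xs ys} → Increasing xs → Increasing ys → (∀ v → v ∈ xs → v ∈ ys) →
                 length ys ≡ suc (length xs) → Σ (Fin (length ys)) λ i → removeAt ys i ≡ xs
codim-one-face {xs} {ys} inc inc′ xs⊆ys len
  with ∃-lookup∉ xs (increasing⇒unique inc′) (subst (length xs <_) (sym len) ≤-refl)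
... | i , y∉ = i , sym (increasing-⊆-length⇒≡ inc (AllPairs-removeAt ys i inc′) xs⊆ys-i
                         (≤-reflexive (suc-injective (trans (sym (length-removeAt′ ys i)) len))))
  where
  xs⊆ys-i : ∀ v → v ∈ xs → v ∈ removeAt ys i
  xs⊆ys-i v v∈ = ∈-removeAt⁺ ys i (xs⊆ys v v∈) (λ e → y∉ (subst (_∈ xs) e v∈))

insert : ℕ → List ℕ → List ℕ
insert x [] = x ∷ []
insert x (y ∷ ys) with x <? y
... | yes _ = x ∷ y ∷ ys
... | no _  = y ∷ insert x ys

∈-insert⁻ : ∀ {v} x ys → v ∈ insert x ys → v ≡ x ⊎ v ∈ ys
∈-insert⁻ x [] (here p) = inj₁ p
∈-insert⁻ x (y ∷ ys) p with x <? y
∈-insert⁻ x (y ∷ ys) (here p)  | yes _ = inj₁ p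
∈-insert⁻ x (y ∷ ys) (there p) | yes _ = inj₂ p
∈-insert⁻ x (y ∷ ys) (here p)  | no _  = inj₂ (here p)
∈-insert⁻ x (y ∷ ys) (there p) | no _ with ∈-insert⁻ x ys p
... | inj₁ q = inj₁ q
... | inj₂ q = inj₂ (there q)

∈-insert-self : ∀ x ys → x ∈ insert x ys
∈-insert-self x [] = here refl
∈-insert-self x (y ∷ ys) with x <? y
... | yes _ = here refl
... | no _  = there (∈-insert-self x ys)

∈-insert⁺ : ∀ {v} x ys → v ∈ ys → v ∈ insert x ys
∈-insert⁺ x (y ∷ ys) p with x <? y
∈-insert⁺ x (y ∷ ys) p         | yes _ = there p
∈-insert⁺ x (y ∷ ys) (here p)  | no _  = here p
∈-insert⁺ x (y ∷ ys) (there p) | no _  = there (∈-insert⁺ x ys p)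

length-insert : ∀ x ys → length (insert x ys) ≡ suc (length ys)
length-insert x [] = refl
length-insert x (y ∷ ys) with x <? y
... | yes _ = refl
... | no _  = cong suc (length-insert x ys)

insert-increasing : ∀ x {ys} → x ∉ ys → Increasing ys → Increasing (insert x ys)
insert-increasing x {[]} _ _ = [] ∷ []
insert-increasing x {y ∷ ys} x∉ (y< ∷ inc) with x <? y
... | yes x<y = All.tabulate x<all ∷ y< ∷ inc
  where
  x<all : ∀ {v} → v ∈ y ∷ ys → x < v
  x<all (here refl) = x<y
  x<all (there p)   = <-trans x<y (All-lookup y< p)
... | no x≮y = All.tabulate y<all ∷ insert-increasing x (λ p → x∉ (there p)) inc
  where
  y<all : ∀ {v} → v ∈ insert x ys → y < v
  y<all p with ∈-insert⁻ x ys p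
  ... | inj₁ refl = ≤∧≢⇒< (≮⇒≥ x≮y) (λ e → x∉ (here (sym e)))
  ... | inj₂ q    = All-lookup y< q

-- The arboreal complex

module ArborealComplex {d k : ℕ} (A : Arboreal d k) where
  open Arboreal A

  Boundary : ℕ → List ℕ → Set
  Boundary n = BoundaryCell d (B n)

  module _ {n ρ} (bd : Boundary n ρ) where
    boundary-cell : B n ρ
    boundary-cell = proj₁ bd

    boundary-length : length ρ ≡ d
    boundary-length = proj₁ (proj₂ bd)

    parent : List ℕ
    parent = proj₁ (proj₂ (proj₂ bd))

    parent-cell : B n parent
    parent-cell = proj₁ (proj₁ (proj₂ (proj₂ (proj₂ bd))))

    parent-length : length parent ≡ suc d
    parent-length = proj₁ (proj₂ (proj₁ (proj₂ (proj₂ (proj₂ bd)))))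

    ⊆-parent : ρ ⊆ parent
    ⊆-parent = proj₂ (proj₂ (proj₁ (proj₂ (proj₂ (proj₂ bd)))))

    parent-unique : ∀ τ → B n τ → length τ ≡ suc d → ρ ⊆ τ → τ ≡ parent
    parent-unique = proj₂ (proj₂ (proj₂ (proj₂ bd)))

  B-step : ∀ {n σ} → B n σ → B (suc n) σ
  B-step {n} {σ} p = proj₂ (B-suc n σ) (inj₁ p)

  B-mono : ∀ {σ} m n → m ≤ n → B m σ → B n σ
  B-mono m zero    z≤n p = p
  B-mono m (suc n) m≤n p with m≤n⇒m<n∨m≡n m≤n
  ... | inj₁ m<1+n = B-step (B-mono m n (≤-pred m<1+n) p)
  ... | inj₂ refl  = p

  B-increasing : ∀ {n σ} → B n σ → Increasing σ
  B-increasing {zero}  {σ} p = strict⇒increasing (proj₁ (proj₁ (B-zero σ) p))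
  B-increasing {suc n} {σ} p with proj₁ (B-suc n σ) p
  ... | inj₁ q                    = B-increasing q
  ... | inj₂ (_ , _ , _ , st , _) = strict⇒increasing st

  𝒯∈B₀ : B 0 𝒯
  𝒯∈B₀ = proj₂ (B-zero 𝒯) (𝒯-strict , λ _ v∈ → v∈)

  B-face : ∀ {n σ τ} → B n τ → Increasing σ → σ ⊆ τ → B n σ
  B-face {zero}  {σ} {τ} p inc σ⊆τ = proj₂ (B-zero σ) (increasing⇒strict inc , λ v v∈ → proj₂ (proj₁ (B-zero τ) p) v (σ⊆τ v v∈))
  B-face {suc n} {σ} {τ} p inc σ⊆τ with proj₁ (B-suc n τ) p
  ... | inj₁ q = B-step (B-face q inc σ⊆τ)
  ... | inj₂ (ρ , j , bd , _ , τ⊆) = proj₂ (B-suc n σ) (inj₂ (ρ , j , bd , increasing⇒strict inc , λ v v∈ → τ⊆ v (σ⊆τ v v∈)))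

  new-fresh≤ : ∀ {m n ρ σ} j → Boundary m ρ → n ≤ m → B n σ → new m ρ j ∉ σ
  new-fresh≤ {m} {n} {ρ} {σ} j bd n≤m p = new-fresh m ρ j bd σ (B-mono n m n≤m p)

  child : ℕ → List ℕ → Fin (k ∸ 1) → List ℕ
  child m ρ j = insert (new m ρ j) ρ

  module _ {m ρ} (j : Fin (k ∸ 1)) (bd : Boundary m ρ) where
    child-increasing : Increasing (child m ρ j)
    child-increasing = insert-increasing _ (new-fresh≤ j bd ≤-refl (boundary-cell bd)) (B-increasing (boundary-cell bd))

    child-length : length (child m ρ j) ≡ suc d
    child-length = trans (length-insert (new m ρ j) ρ) (cong suc (boundary-length bd))

    child-cell : B (suc m) (child m ρ j)
    child-cell = proj₂ (B-suc m _) (inj₂ (ρ , j , bd , increasing⇒strict child-increasing , split))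
      where
      split : ∀ v → v ∈ child m ρ j → v ∈ ρ ⊎ v ≡ new m ρ j
      split v p with ∈-insert⁻ (new m ρ j) ρ p
      ... | inj₁ e = inj₂ e
      ... | inj₂ q = inj₁ q

  new∈child : ∀ m ρ j → new m ρ j ∈ child m ρ j
  new∈child m ρ j = ∈-insert-self (new m ρ j) ρ

  ⊆-child : ∀ m ρ j → ρ ⊆ child m ρ j
  ⊆-child m ρ j v p = ∈-insert⁺ (new m ρ j) ρ p

  new-injective : ∀ {m m′ ρ ρ′ j j′} → Boundary m ρ → Boundary m′ ρ′ → new m ρ j ≡ new m′ ρ′ j′ →
                  m ≡ m′ × ρ ≡ ρ′ × j ≡ j′
  new-injective {m} {m′} {ρ} {ρ′} {j} {j′} bd bd′ e with <-cmp m m′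
  ... | tri< m<m′ _ _ = ⊥-elim (new-fresh≤ j′ bd′ m<m′ (child-cell j bd) (subst (_∈ child m ρ j) e (new∈child m ρ j)))
  ... | tri> _ _ m>m′ = ⊥-elim (new-fresh≤ j bd m>m′ (child-cell j′ bd′) (subst (_∈ child m′ ρ′ j′) (sym e) (new∈child m′ ρ′ j′)))
  ... | tri≈ _ refl _ with new-inj m ρ ρ′ j j′ bd bd′ e
  ... | ρ≡ρ′ , j≡j′ = refl , ρ≡ρ′ , j≡j′

  child-injective : ∀ {m m′ ρ ρ′ j j′} → Boundary m ρ → Boundary m′ ρ′ → child m ρ j ≡ child m′ ρ′ j′ →
                    m ≡ m′ × ρ ≡ ρ′ × j ≡ j′
  child-injective {m} {m′} {ρ} {ρ′} {j} {j′} bd bd′ e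
    with ∈-insert⁻ (new m′ ρ′ j′) ρ′ (subst (new m ρ j ∈_) e (new∈child m ρ j))
       | ∈-insert⁻ (new m ρ j) ρ (subst (new m′ ρ′ j′ ∈_) (sym e) (new∈child m′ ρ′ j′))
  ... | inj₁ q | _ = new-injective bd bd′ q
  ... | inj₂ _ | inj₁ q with new-injective bd′ bd q
  ...   | refl , refl , refl = refl , refl , refl
  child-injective {m} {m′} {j = j} {j′} bd bd′ e | inj₂ p | inj₂ q with m ≤? m′
  ... | yes m≤m′ = ⊥-elim (new-fresh≤ j′ bd′ m≤m′ (boundary-cell bd) q)
  ... | no m≰m′  = ⊥-elim (new-fresh≤ j bd (≰⇒≥ m≰m′) (boundary-cell bd′) p)

  -- A derivation records how a d-cell arose: by attaching it at stage m across a boundary face of an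
  -- earlier derived d-cell; the index s is the stage at which the d-cell appears.
  data Derivation : ℕ → List ℕ → Set where
    initial : Derivation 0 𝒯
    attach  : ∀ {m ρ s τ} (j : Fin (k ∸ 1)) → Boundary m ρ → Derivation s τ → s ≤ m → ρ ⊆ τ →
              Derivation (suc m) (child m ρ j)

  derivation-cell : ∀ {s τ} → Derivation s τ → B s τ
  derivation-cell initial               = 𝒯∈B₀
  derivation-cell (attach j bd _ _ _)   = child-cell j bd

  derivation-length : ∀ {s τ} → Derivation s τ → length τ ≡ suc d
  derivation-length initial             = 𝒯-dim
  derivation-length (attach j bd _ _ _) = child-length j bd

  derivation-increasing : ∀ {s τ} → Derivation s τ → Increasing τ
  derivation-increasing dc = B-increasing (derivation-cell dc)

  B₀-top : ∀ {τ} → B 0 τ → length τ ≡ suc d → τ ≡ 𝒯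
  B₀-top {τ} p len = increasing-⊆-length⇒≡ (B-increasing p) (strict⇒increasing 𝒯-strict) (proj₂ (proj₁ (B-zero τ) p))
                       (≤-reflexive (trans 𝒯-dim (sym len)))

  top-of-step≡child : ∀ {n τ ρ} j → Boundary n ρ → B (suc n) τ → length τ ≡ suc d →
                      (∀ v → v ∈ τ → v ∈ ρ ⊎ v ≡ new n ρ j) → τ ≡ child n ρ j
  top-of-step≡child {n} {τ} {ρ} j bd p len τ⊆ =
    increasing-⊆-length⇒≡ (B-increasing p) (child-increasing j bd) τ⊆child (≤-reflexive (trans (child-length j bd) (sym len)))
    where
    τ⊆child : ∀ v → v ∈ τ → v ∈ child n ρ j
    τ⊆child v v∈ with τ⊆ v v∈
    ... | inj₁ q    = ⊆-child n ρ j v q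
    ... | inj₂ refl = new∈child n ρ j

  mutual
    derive : ∀ {n τ} → B n τ → length τ ≡ suc d → Σ ℕ λ s → Derivation s τ × s ≤ n
    derive {zero} p len with B₀-top p len
    ... | refl = 0 , initial , z≤n
    derive {suc n} {τ} p len with proj₁ (B-suc n τ) p
    ... | inj₁ q with derive q len
    ...   | s , dc , s≤n = s , dc , m≤n⇒m≤1+n s≤n
    derive {suc n} {τ} p len | inj₂ (ρ , j , bd , _ , τ⊆) with top-of-step≡child j bd p len τ⊆
    ... | refl = derive-child j bd

    derive-child : ∀ {n ρ} j → Boundary n ρ → Σ ℕ λ s → Derivation s (child n ρ j) × s ≤ suc n
    derive-child {n} j bd with derive (parent-cell bd) (parent-length bd)
    ... | s , dc , s≤n = suc n , attach j bd dc s≤n (⊆-parent bd) , ≤-refl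

  record Home (σ : List ℕ) : Set where
    constructor home
    field
      stage      : ℕ
      top        : List ℕ
      derivation : Derivation stage top
      ⊆-top      : σ ⊆ top

  home-of : ∀ {n σ} → B n σ → Home σ
  home-of {zero}  {σ} p = home 0 𝒯 initial (proj₂ (proj₁ (B-zero σ) p))
  home-of {suc n} {σ} p with proj₁ (B-suc n σ) p
  ... | inj₁ q = home-of q
  ... | inj₂ (ρ , j , bd , _ , σ⊆) with derive-child j bd
  ... | s , dc , _ = home s (child n ρ j) dc σ⊆child
    where
    σ⊆child : σ ⊆ child n ρ j
    σ⊆child v v∈ with σ⊆ v v∈
    ... | inj₁ q    = ⊆-child n ρ j v q
    ... | inj₂ refl = new∈child n ρ j

  derived-parent : ∀ {m ρ s τ} (bd : Boundary m ρ) → Derivation s τ → s ≤ m → ρ ⊆ τ → τ ≡ parent bd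
  derived-parent {m} bd dc s≤m ρ⊆τ = parent-unique bd _ (B-mono _ m s≤m (derivation-cell dc)) (derivation-length dc) ρ⊆τ

  derived∋new≡child : ∀ {m ρ s τ} j → Boundary m ρ → Derivation s τ → s ≤ suc m → new m ρ j ∈ τ → τ ≡ child m ρ j
  derived∋new≡child j bd initial _ x∈ = ⊥-elim (new-fresh≤ j bd z≤n 𝒯∈B₀ x∈)
  derived∋new≡child j bd (attach {ρ = ρ′} j′ bd′ _ _ _) (s≤s s≤m) x∈ with ∈-insert⁻ _ ρ′ x∈
  ... | inj₂ q = ⊥-elim (new-fresh≤ j bd s≤m (boundary-cell bd′) q)
  ... | inj₁ q with new-injective bd bd′ q
  ...   | refl , refl , refl = refl

  ⊆child⇒⊆boundary : ∀ {m ρ} j σ → σ ⊆ child m ρ j → new m ρ j ∉ σ → σ ⊆ ρ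
  ⊆child⇒⊆boundary {m} {ρ} j σ σ⊆ new∉ v v∈ with ∈-insert⁻ (new m ρ j) ρ (σ⊆ v v∈)
  ... | inj₁ refl = ⊥-elim (new∉ v∈)
  ... | inj₂ v∈ρ  = v∈ρ

  𝒯≢child : ∀ {m ρ} j → Boundary m ρ → 𝒯 ≢ child m ρ j
  𝒯≢child {m} {ρ} j bd e = new-fresh≤ j bd z≤n 𝒯∈B₀ (subst (new m ρ j ∈_) (sym e) (new∈child m ρ j))

  -- The stage at which a (d-1)-cell ρ first lies on the boundary, together with its unique d-cell then.
  record Birth (ρ : List ℕ) : Set where
    field
      stage          : ℕ
      boundary       : Boundary stage ρ
      parent-stage   : ℕ
      parent-derived : Derivation parent-stage (parent boundary)
      parent-stage≤  : parent-stage ≤ stage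

  birth : ∀ {n ρ} → B n ρ → length ρ ≡ d → Birth ρ
  birth {zero} {ρ} p len = record
    { stage = 0 ; parent-stage = 0 ; parent-derived = initial ; parent-stage≤ = z≤n
    ; boundary = p , len , 𝒯 , (𝒯∈B₀ , 𝒯-dim , proj₂ (proj₁ (B-zero ρ) p)) , λ _ q len′ _ → B₀-top q len′ }
  birth {suc n} {ρ} p len with proj₁ (B-suc n ρ) p
  ... | inj₁ q = birth q len
  ... | inj₂ (ρ′ , j , bd′ , _ , ρ⊆) with new n ρ′ j ∈? ρ
  ... | no x∉ = birth (B-face (boundary-cell bd′) (B-increasing p) ρ⊆ρ′) len
    where
    ρ⊆ρ′ : ρ ⊆ ρ′
    ρ⊆ρ′ v v∈ with ρ⊆ v v∈
    ... | inj₁ q    = q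
    ... | inj₂ refl = ⊥-elim (x∉ v∈)
  ... | yes x∈ with derive-child j bd′
  ... | s , dc , s≤ = record
    { stage = suc n ; parent-stage = s ; parent-derived = dc ; parent-stage≤ = s≤
    ; boundary = p , len , child n ρ′ j , (child-cell j bd′ , child-length j bd′ , ρ⊆child) , unique }
    where
    ρ⊆child : ρ ⊆ child n ρ′ j
    ρ⊆child v v∈ with ρ⊆ v v∈
    ... | inj₁ q    = ⊆-child n ρ′ j v q
    ... | inj₂ refl = new∈child n ρ′ j
    unique : ∀ τ → B (suc n) τ → length τ ≡ suc d → ρ ⊆ τ → τ ≡ child n ρ′ j
    unique τ q len′ ρ⊆τ with proj₁ (B-suc n τ) q
    ... | inj₁ q′ = ⊥-elim (new-fresh≤ j bd′ ≤-refl q′ (ρ⊆τ _ x∈))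
    ... | inj₂ (ρ″ , j″ , bd″ , _ , τ⊆) with τ⊆ _ (ρ⊆τ _ x∈)
    ...   | inj₁ r = ⊥-elim (new-fresh≤ j bd′ ≤-refl (boundary-cell bd″) r)
    ...   | inj₂ e with new-injective bd′ bd″ e
    ...     | refl , refl , refl = top-of-step≡child j bd′ q len′ τ⊆

  module _ {ρ : List ℕ} (bi : Birth ρ) where
    open Birth bi

    coface-cases : ∀ {n τ} → B n τ → length τ ≡ suc d → ρ ⊆ τ →
                   τ ≡ parent boundary ⊎ Σ (Fin (k ∸ 1)) λ j → τ ≡ child stage ρ j
    coface-cases {n} {τ} p len ρ⊆τ with n ≤? stage
    ... | yes n≤ = inj₁ (parent-unique boundary τ (B-mono n stage n≤ p) len ρ⊆τ)
    coface-cases {zero}  p len ρ⊆τ | no 0≰ = ⊥-elim (0≰ z≤n)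
    coface-cases {suc n} {τ} p len ρ⊆τ | no n≰ with proj₁ (B-suc n τ) p
    ... | inj₁ q = coface-cases q len ρ⊆τ
    ... | inj₂ (ρ′ , j , bd′ , _ , τ⊆) =
      attached-across ρ′ j bd′ τ⊆
        (increasing-⊆-length⇒≡ (B-increasing (boundary-cell boundary)) (B-increasing (boundary-cell bd′)) ρ⊆ρ′
           (≤-reflexive (trans (boundary-length bd′) (sym (boundary-length boundary)))))
      where
      stage≤n : stage ≤ n
      stage≤n = ≤-pred (≰⇒> n≰)
      ρ⊆ρ′ : ρ ⊆ ρ′
      ρ⊆ρ′ v v∈ with τ⊆ v (ρ⊆τ v v∈)
      ... | inj₁ q    = q
      ... | inj₂ refl = ⊥-elim (new-fresh≤ j bd′ stage≤n (boundary-cell boundary) v∈)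
      attached-across : ∀ ρ′ j (bd′ : Boundary n ρ′) → (∀ v → v ∈ τ → v ∈ ρ′ ⊎ v ≡ new n ρ′ j) → ρ ≡ ρ′ →
                        τ ≡ parent boundary ⊎ Σ (Fin (k ∸ 1)) λ j → τ ≡ child stage ρ j
      attached-across .ρ j bd′ τ⊆ refl with n ≟ stage
      ... | yes refl = inj₂ (j , top-of-step≡child j bd′ p len τ⊆)
      -- Once its children are attached, ρ lies in several d-cells and is never a boundary cell again.
      ... | no n≢    = ⊥-elim (new-fresh≤ j boundary ≤-refl (parent-cell boundary)
                                 (subst (new stage ρ j ∈_) (trans child≡ (sym parent≡)) (new∈child stage ρ j)))
        where
        stage<n : suc stage ≤ n
        stage<n = ≤∧≢⇒< stage≤n (λ e → n≢ (sym e))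
        child≡ : child stage ρ j ≡ parent bd′
        child≡ = parent-unique bd′ _ (B-mono (suc stage) n stage<n (child-cell j boundary)) (child-length j boundary) (⊆-child stage ρ j)
        parent≡ : parent boundary ≡ parent bd′
        parent≡ = parent-unique bd′ _ (B-mono stage n stage≤n (parent-cell boundary)) (parent-length boundary) (⊆-parent boundary)

⊑-trans : ∀ {X : PreMC} {a b c} → _⊑_ X a b → _⊑_ X b c → _⊑_ X a c
⊑-trans ⊑-refl          b⊑c = b⊑c
⊑-trans (⊑-step a∈ a⊑) b⊑c = ⊑-step a∈ (⊑-trans a⊑ b⊑c)

ordering-identity : ∀ {X : PreMC} {d k} {ω} → IsKOrdering X d (suc k) ω → ∀ b → IsDimMCell X (d ∸ 1) b →
             ∀ a → δ X b a → ω b zero a ≡ a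
ordering-identity {ω = ω} hω b hb a a∈δ =
  IsKOrdering.inj hω b hb zero (ω b zero a) a (IsKOrdering.maps-to hω b hb zero a a∈δ) a∈δ
    (sym (IsKOrdering.hom hω b hb zero zero a a∈δ))

coface-dim : ∀ {X : PreMC} {n a b} → IsDimMCell X n b → δ X b a → IsDimMCell X (suc n) a
coface-dim {a = a} (_ , b-dim) (a-cell , i , face≡b) =
  a-cell , trans (length-removeAt′ (ι a) i) (cong suc (trans (cong (λ c → length (ι c)) face≡b) b-dim))

∧≡true⁻ : ∀ {x y} → (x ∧ y) ≡ true → x ≡ true × y ≡ true
∧≡true⁻ {true} {true} _ = refl , refl

∧≡true⁺ : ∀ {x y} → x ≡ true → y ≡ true → (x ∧ y) ≡ true
∧≡true⁺ refl refl = refl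

≡true-ext : ∀ {x y} → (x ≡ true → y ≡ true) → (y ≡ true → x ≡ true) → x ≡ y
≡true-ext {false} {false} _ _ = refl
≡true-ext {false} {true}  _ g = g refl
≡true-ext {true}  {false} f _ = sym (f refl)
≡true-ext {true}  {true}  _ _ = refl

firstFailure : (ℕ → Bool) → (xs : List ℕ) → Maybe (Fin (length xs))
firstFailure P [] = nothing
firstFailure P (x ∷ xs) with P x
... | false = just zero
... | true with firstFailure P xs
...   | nothing = nothing
...   | just i  = just (suc i)

firstFailure-nothing : ∀ P xs → firstFailure P xs ≡ nothing → ∀ v → v ∈ xs → P v ≡ true
firstFailure-nothing P (x ∷ xs) e v v∈ with P x in Px
firstFailure-nothing P (x ∷ xs) () v v∈ | false
... | true with firstFailure P xs in ff
firstFailure-nothing P (x ∷ xs) e v (here refl) | true | nothing = Px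
firstFailure-nothing P (x ∷ xs) e v (there v∈) | true | nothing = firstFailure-nothing P xs ff v v∈
firstFailure-nothing P (x ∷ xs) () v v∈        | true | just i

firstFailure-just : ∀ P xs i → firstFailure P xs ≡ just i → P (lookup xs i) ≡ false
firstFailure-just P (x ∷ xs) i e with P x in Px
firstFailure-just P (x ∷ xs) i refl | false = Px
... | true with firstFailure P xs in ff
firstFailure-just P (x ∷ xs) i ()   | true | nothing
firstFailure-just P (x ∷ xs) i refl | true | just j = firstFailure-just P xs j ff

firstFailure-cong : ∀ P Q xs → (∀ v → v ∈ xs → P v ≡ Q v) → firstFailure P xs ≡ firstFailure Q xs
firstFailure-cong P Q [] _ = refl
firstFailure-cong P Q (x ∷ xs) P≗Q with P x | Q x | P≗Q x (here refl)
... | false | .false | refl = refl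
... | true  | .true  | refl
  with firstFailure P xs | firstFailure Q xs | firstFailure-cong P Q xs (λ v v∈ → P≗Q v (there v∈))
...   | nothing | .nothing | refl = refl
...   | just i  | .(just i) | refl = refl

firstFailure-[] : ∀ P xs → length xs ≤ 0 → firstFailure P xs ≡ nothing
firstFailure-[] P [] _ = refl

-- a ↾ P is the face of the multicell a spanned by the vertices satisfying P, reached by repeatedly
-- passing to the face opposite the first failing vertex.
module Restriction {d k : ℕ} (O : PreObj d k) (hO : IsObj O) where
  open PreObj O renaming (X to Y; γ to γ̂)
  open IsObj hO
  open PreMC Y
  open IsMulticomplex multicomplex

  restrictₙ : ℕ → (ℕ → Bool) → MCell Y → MCell Y
  restrictₙ zero    P a = a
  restrictₙ (suc n) P a with firstFailure P (ι a)
  ... | nothing = a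
  ... | just i  = restrictₙ n P (face Y a i)

  _↾_ : MCell Y → (ℕ → Bool) → MCell Y
  a ↾ P = restrictₙ (length (ι a)) P a

  ι-increasing : ∀ {a} → IsMCell Y a → Increasing (ι a)
  ι-increasing p = strict⇒increasing (cell-strict p)

  ι-unique : ∀ {a} → IsMCell Y a → Unique (ι a)
  ι-unique {a} p = increasing⇒unique (ι-increasing {a} p)

  face-mcell : ∀ {a} i → IsMCell Y a → IsMCell Y (face Y a i)
  face-mcell {a} i p = cell-closed p (increasing⇒strict (AllPairs-removeAt (ι a) i (ι-increasing {a} p))) (λ v → ∈-removeAt⁻ (ι a) i)

  length-face≤ : ∀ a i {r} → length (ι a) ≤ suc r → length (ι (face Y a i)) ≤ r
  length-face≤ a i {r} l = subst (_≤ r) (sym (length-removeAt (ι a) i)) (pred-mono-≤ l)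

  restrictₙ-fuel : ∀ n m P a → length (ι a) ≤ n → length (ι a) ≤ m → restrictₙ n P a ≡ restrictₙ m P a
  restrictₙ-fuel zero zero P a _ _ = refl
  restrictₙ-fuel zero (suc m) P a l _ with firstFailure P (ι a) | firstFailure-[] P (ι a) l
  ... | nothing | refl = refl
  restrictₙ-fuel (suc n) zero P a _ l with firstFailure P (ι a) | firstFailure-[] P (ι a) l
  ... | nothing | refl = refl
  restrictₙ-fuel (suc n) (suc m) P a l l′ with firstFailure P (ι a)
  ... | nothing = refl
  ... | just i  = restrictₙ-fuel n m P (face Y a i) (length-face≤ a i l) (length-face≤ a i l′)

  restrictₙ-⊆ : ∀ n P a {v} → v ∈ ι (restrictₙ n P a) → v ∈ ι a
  restrictₙ-⊆ zero P a p = p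
  restrictₙ-⊆ (suc n) P a p with firstFailure P (ι a)
  ... | nothing = p
  ... | just i  = ∈-removeAt⁻ (ι a) i (restrictₙ-⊆ n P (face Y a i) p)

  restrictₙ-satisfies : ∀ n P a {v} → length (ι a) ≤ n → v ∈ ι (restrictₙ n P a) → P v ≡ true
  restrictₙ-satisfies zero P (mc [] _) _ ()
  restrictₙ-satisfies (suc n) P a {v} l p with firstFailure P (ι a) in e
  ... | nothing = firstFailure-nothing P (ι a) e v p
  ... | just i  = restrictₙ-satisfies n P (face Y a i) (length-face≤ a i l) p

  restrictₙ-keeps : ∀ n P a {v} → IsMCell Y a → v ∈ ι a → P v ≡ true → v ∈ ι (restrictₙ n P a)
  restrictₙ-keeps zero P a _ p _ = p
  restrictₙ-keeps (suc n) P a {v} c p Pv with firstFailure P (ι a) in e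
  ... | nothing = p
  ... | just i  = restrictₙ-keeps n P (face Y a i) (face-mcell {a} i c) (∈-removeAt⁺ (ι a) i p v≢) Pv
    where
    v≢ : v ≢ lookup (ι a) i
    v≢ refl with trans (sym Pv) (firstFailure-just P (ι a) i e)
    ... | ()

  restrictₙ-mcell : ∀ n P a → IsMCell Y a → IsMCell Y (restrictₙ n P a)
  restrictₙ-mcell zero P a c = c
  restrictₙ-mcell (suc n) P a c with firstFailure P (ι a)
  ... | nothing = c
  ... | just i  = restrictₙ-mcell n P (face Y a i) (face-mcell {a} i c)

  restrictₙ-length : ∀ n P a → length (ι (restrictₙ n P a)) ≤ length (ι a)
  restrictₙ-length zero P a = ≤-refl
  restrictₙ-length (suc n) P a with firstFailure P (ι a)
  ... | nothing = ≤-refl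
  ... | just i  = ≤-trans (restrictₙ-length n P (face Y a i))
                          (subst (_≤ length (ι a)) (sym (length-removeAt (ι a) i)) pred[n]≤n)

  restrictₙ-all : ∀ n P a → (∀ v → v ∈ ι a → P v ≡ true) → restrictₙ n P a ≡ a
  restrictₙ-all zero P a _ = refl
  restrictₙ-all (suc n) P a all with firstFailure P (ι a) in e
  ... | nothing = refl
  ... | just i with trans (sym (all _ (∈-lookup i))) (firstFailure-just P (ι a) i e)
  ...   | ()

  restrictₙ-cong : ∀ n P Q a → (∀ v → v ∈ ι a → P v ≡ Q v) → restrictₙ n P a ≡ restrictₙ n Q a
  restrictₙ-cong zero P Q a _ = refl
  restrictₙ-cong (suc n) P Q a P≗Q
    with firstFailure P (ι a) | firstFailure Q (ι a) | firstFailure-cong P Q (ι a) P≗Q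
  ... | nothing | .nothing  | refl = refl
  ... | just i  | .(just i) | refl = restrictₙ-cong n P Q (face Y a i) (λ v v∈ → P≗Q v (∈-removeAt⁻ (ι a) i v∈))

  -- The two faces of a opposite distinct vertices y and y₀ share the face opposite {y , y₀}, and
  -- consistency of the multicomplex makes the two glued copies of it coincide.
  faces-commute : ∀ Top a i i₀ → IsMCell Y Top → _⊑_ Y a Top → IsMCell Y a → i₀ ≢ i →
                  Σ (Fin (length (ι (face Y a i)))) λ i′ → Σ (Fin (length (ι (face Y a i₀)))) λ j′ →
                    lookup (ι (face Y a i)) i′ ≡ lookup (ι a) i₀ ×
                    lookup (ι (face Y a i₀)) j′ ≡ lookup (ι a) i ×
                    face Y (face Y a i) i′ ≡ face Y (face Y a i₀) j′
  faces-commute Top a i i₀ cTop a⊑ ca i₀≢i =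
    i′ , j′ , sym (lookup-index y₀∈b) , sym (lookup-index y∈b′) ,
    consistent Top b b′ i′ j′ cTop (⊑-step (i , refl) a⊑) (⊑-step (i₀ , refl) a⊑)
      (trans (length-removeAt (ι a) i) (sym (length-removeAt (ι a) i₀))) common-face same-face
    where
    u = ι-unique {a} ca
    y = lookup (ι a) i
    y₀ = lookup (ι a) i₀
    b = face Y a i
    b′ = face Y a i₀
    y₀≢y : y₀ ≢ y
    y₀≢y eq = i₀≢i (lookup-injective (ι a) u i₀ i eq)
    y₀∈b : y₀ ∈ ι b
    y₀∈b = ∈-removeAt⁺ (ι a) i (∈-lookup i₀) y₀≢y
    y∈b′ : y ∈ ι b′
    y∈b′ = ∈-removeAt⁺ (ι a) i₀ (∈-lookup i) (λ eq → y₀≢y (sym eq))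
    i′ = Any.index y₀∈b
    j′ = Any.index y∈b′
    ridge : ∀ v → v ∈ removeAt (ι b) i′ ⇔ (v ∈ ι a × v ≢ y × v ≢ y₀)
    ridge v = subst (λ z → v ∈ removeAt (ι b) i′ ⇔ (v ∈ ι a × v ≢ y × v ≢ z)) (sym (lookup-index y₀∈b))
                    (∈-removeAt² (ι a) u i i′)
    ridge′ : ∀ v → v ∈ removeAt (ι b′) j′ ⇔ (v ∈ ι a × v ≢ y₀ × v ≢ y)
    ridge′ v = subst (λ z → v ∈ removeAt (ι b′) j′ ⇔ (v ∈ ι a × v ≢ y₀ × v ≢ z)) (sym (lookup-index y∈b′))
                     (∈-removeAt² (ι a) u i₀ j′)
    common-face : ∀ v → v ∈ removeAt (ι b) i′ ⇔ (v ∈ ι b × v ∈ ι b′)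
    common-face v = (λ p → let (v∈ , _ , v≢y₀) = proj₁ (ridge v) p in ∈-removeAt⁻ (ι b) i′ p , ∈-removeAt⁺ (ι a) i₀ v∈ v≢y₀)
                  , (λ (p , q) → proj₂ (ridge v) (∈-removeAt⁻ (ι a) i p , ∈-removeAt⇒≢lookup (ι a) i u p
                                                 , ∈-removeAt⇒≢lookup (ι a) i₀ u q))
    same-face : removeAt (ι b) i′ ≡ removeAt (ι b′) j′
    same-face = increasing-ext (AllPairs-removeAt (ι b) i′ (AllPairs-removeAt (ι a) i (ι-increasing {a} ca)))
                               (AllPairs-removeAt (ι b′) j′ (AllPairs-removeAt (ι a) i₀ (ι-increasing {a} ca)))
                  (λ v p → let (v∈ , v≢y , v≢y₀) = proj₁ (ridge v) p in proj₂ (ridge′ v) (v∈ , v≢y₀ , v≢y))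
                  (λ v p → let (v∈ , v≢y₀ , v≢y) = proj₁ (ridge′ v) p in proj₂ (ridge v) (v∈ , v≢y , v≢y₀))

  restrictₙ-face-exact : ∀ n Top a i P → IsMCell Y Top → IsMCell Y a → _⊑_ Y a Top → length (ι a) ≡ suc n →
                         P (lookup (ι a) i) ≡ false → restrictₙ n P (face Y a i) ≡ restrictₙ (suc n) P a
  restrictₙ-face-exact n Top a i P cTop ca a⊑ len Py≡false with firstFailure P (ι a) in e
  ... | nothing with trans (sym (firstFailure-nothing P (ι a) e _ (∈-lookup i))) Py≡false
  ...   | ()
  restrictₙ-face-exact n Top a i P cTop ca a⊑ len Py≡false | just i₀ with i₀ Fin.≟ i
  ... | yes refl = refl
  restrictₙ-face-exact zero Top (mc (_ ∷ []) _) zero P cTop ca a⊑ len Py≡false | just zero | no i₀≢i = ⊥-elim (i₀≢i refl)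
  restrictₙ-face-exact (suc n) Top a i P cTop ca a⊑ len Py≡false | just i₀ | no i₀≢i
    with faces-commute Top a i i₀ cTop a⊑ ca i₀≢i
  ... | i′ , j′ , lookup-i′ , lookup-j′ , ridge =
    trans (sym (restrictₙ-face-exact n Top (face Y a i) i′ P cTop (face-mcell {a} i ca) (⊑-step (i , refl) a⊑)
                  (trans (length-removeAt (ι a) i) (cong pred len))
                  (trans (cong P lookup-i′) (firstFailure-just P (ι a) i₀ e))))
      (trans (cong (restrictₙ n P) ridge)
        (restrictₙ-face-exact n Top (face Y a i₀) j′ P cTop (face-mcell {a} i₀ ca) (⊑-step (i₀ , refl) a⊑)
           (trans (length-removeAt (ι a) i₀) (cong pred len))
           (trans (cong P lookup-j′) Py≡false)))

  restrictₙ-face : ∀ n Top a i P → IsMCell Y Top → IsMCell Y a → _⊑_ Y a Top → length (ι a) ≤ suc n →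
                   P (lookup (ι a) i) ≡ false → restrictₙ n P (face Y a i) ≡ restrictₙ (suc n) P a
  restrictₙ-face n Top a i P cTop ca a⊑ l Py≡false =
    trans (restrictₙ-fuel n L P (face Y a i) (length-face≤ a i l) ≤-refl)
      (trans (restrictₙ-face-exact L Top a i P cTop ca a⊑ (length-removeAt′ (ι a) i) Py≡false)
        (restrictₙ-fuel (suc L) (suc n) P a (≤-reflexive (length-removeAt′ (ι a) i)) l))
    where
    L = length (ι (face Y a i))

  restrictₙ-restrictₙ : ∀ n Top a P Q → IsMCell Y Top → IsMCell Y a → _⊑_ Y a Top → length (ι a) ≤ n →
                        restrictₙ n Q (restrictₙ n P a) ≡ restrictₙ n (λ v → P v ∧ Q v) a
  restrictₙ-restrictₙ zero Top a P Q cTop ca a⊑ l = refl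
  restrictₙ-restrictₙ (suc n) Top a P Q cTop ca a⊑ l with firstFailure P (ι a) in e
  ... | nothing = restrictₙ-cong (suc n) Q (λ v → P v ∧ Q v) a
                    (λ v v∈ → sym (cong (_∧ Q v) (firstFailure-nothing P (ι a) e v v∈)))
  ... | just i =
    trans (restrictₙ-fuel (suc n) n Q (restrictₙ n P (face Y a i)) (m≤n⇒m≤1+n l′) l′)
      (trans (restrictₙ-restrictₙ n Top (face Y a i) P Q cTop (face-mcell {a} i ca) (⊑-step (i , refl) a⊑)
                                 (length-face≤ a i l))
        (restrictₙ-face n Top a i (λ v → P v ∧ Q v) cTop ca a⊑ l
                        (cong (_∧ Q (lookup (ι a) i)) (firstFailure-just P (ι a) i e))))
    where
    l′ : length (ι (restrictₙ n P (face Y a i))) ≤ n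
    l′ = ≤-trans (restrictₙ-length n P (face Y a i)) (length-face≤ a i l)

  ↾-mcell : ∀ P a → IsMCell Y a → IsMCell Y (a ↾ P)
  ↾-mcell P a = restrictₙ-mcell (length (ι a)) P a

  ∈-↾⁻ : ∀ P a {v} → v ∈ ι (a ↾ P) → v ∈ ι a × P v ≡ true
  ∈-↾⁻ P a p = restrictₙ-⊆ (length (ι a)) P a p , restrictₙ-satisfies (length (ι a)) P a ≤-refl p

  ∈-↾⁺ : ∀ P a {v} → IsMCell Y a → v ∈ ι a → P v ≡ true → v ∈ ι (a ↾ P)
  ∈-↾⁺ P a = restrictₙ-keeps (length (ι a)) P a

  ↾-all : ∀ P a → (∀ v → v ∈ ι a → P v ≡ true) → a ↾ P ≡ a
  ↾-all P a = restrictₙ-all (length (ι a)) P a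

  ↾-cong : ∀ P Q a → (∀ v → v ∈ ι a → P v ≡ Q v) → a ↾ P ≡ a ↾ Q
  ↾-cong P Q a = restrictₙ-cong (length (ι a)) P Q a

  ↾-face : ∀ a i P → IsMCell Y a → P (lookup (ι a) i) ≡ false → face Y a i ↾ P ≡ a ↾ P
  ↾-face a i P ca Py≡false =
    trans (restrictₙ-face-exact L a a i P ca ca ⊑-refl (length-removeAt′ (ι a) i) Py≡false)
          (restrictₙ-fuel (suc L) (length (ι a)) P a (≤-reflexive (length-removeAt′ (ι a) i)) ≤-refl)
    where
    L = length (ι (face Y a i))

  ↾-↾ : ∀ a P Q → IsMCell Y a → (a ↾ P) ↾ Q ≡ a ↾ (λ v → P v ∧ Q v)
  ↾-↾ a P Q ca =
    trans (restrictₙ-fuel (length (ι (a ↾ P))) (length (ι a)) Q (a ↾ P) ≤-refl (restrictₙ-length (length (ι a)) P a))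
          (restrictₙ-restrictₙ (length (ι a)) a a P Q ca ca ⊑-refl ≤-refl)

  face≡↾ : ∀ a j Q → IsMCell Y a → Q (lookup (ι a) j) ≡ false →
           (∀ v → v ∈ ι (face Y a j) → Q v ≡ true) → face Y a j ≡ a ↾ Q
  face≡↾ a j Q ca Qy≡false all = trans (sym (↾-all Q (face Y a j) all)) (↾-face a j Q ca Qy≡false)

  colouring-injective : ∀ {a} → IsDimMCell Y d a → ∀ u v → u ∈ ι a → v ∈ ι a → γ̂ u ≡ γ̂ v → u ≡ v
  colouring-injective {a} (c , len) = coloring (ι a) c len

  colour-attained : ∀ {a} → IsDimMCell Y d a → ∀ c → Σ ℕ λ y → y ∈ ι a × γ̂ y ≡ c
  colour-attained {a} (c , len) = injection-onto-Fin γ̂ (ι a) (ι-unique {a} c) len (colouring-injective {a} (c , len))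

-- T_{d,k} is an object of 𝒞_{d,k}

module UniversalProperty (d′ k′ : ℕ) (A : Arboreal (suc d′) (suc k′)) (Γ : ℕ → Fin (suc (suc d′)))
         (hΓ : IsColoring (TComplex A) (suc d′) Γ)
         (Ω : MCell (TComplex A) → Fin (suc k′) → MCell (TComplex A) → MCell (TComplex A))
         (hΩ : IsKOrdering (TComplex A) (suc d′) (suc k′) Ω) where

  open Arboreal A
  open ArborealComplex A
  open IsKOrdering hΩ renaming (trans to Ω-transitive; maps-to to Ω-maps-to; hom to Ω-hom)

  T : PreMC
  T = TComplex A

  ⟨_⟩ : List ℕ → MCell T
  ⟨ σ ⟩ = mc σ zero

  Cell : List ℕ → Set
  Cell = PreMC.cell T

  ⟨⟩-injective : ∀ {σ τ} → ⟨ σ ⟩ ≡ ⟨ τ ⟩ → σ ≡ τ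
  ⟨⟩-injective refl = refl

  B-dim≤ : ∀ {n σ} → B n σ → length σ ≤ suc (suc d′)
  B-dim≤ p with home-of p
  ... | home _ τ dc σ⊆τ = ≤-trans (length-≤-⊆ τ (increasing⇒unique (B-increasing p)) σ⊆τ) (≤-reflexive (derivation-length dc))

  codim-one-∈∂ : ∀ {ρ τ} → Increasing ρ → Increasing τ → ρ ⊆ τ → length τ ≡ suc (length ρ) → _∈∂_ T ⟨ ρ ⟩ ⟨ τ ⟩
  codim-one-∈∂ incρ incτ ρ⊆τ len with codim-one-face incρ incτ ρ⊆τ len
  ... | i , e = i , cong ⟨_⟩ e

  ∈∂⇒⊆ : ∀ {ρ τ} → _∈∂_ T ⟨ ρ ⟩ ⟨ τ ⟩ → ρ ⊆ τ × length τ ≡ suc (length ρ)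
  ∈∂⇒⊆ {ρ} {τ} (i , e) = (λ v v∈ → ∈-removeAt⁻ τ i (subst (v ∈_) (sym (⟨⟩-injective e)) v∈))
                       , trans (length-removeAt′ τ i) (cong (λ σ → suc (length σ)) (⟨⟩-injective e))

  boundary∈∂ : ∀ {m ρ τ} (bd : Boundary m ρ) → Increasing τ → ρ ⊆ τ → length τ ≡ suc (suc d′) → _∈∂_ T ⟨ ρ ⟩ ⟨ τ ⟩
  boundary∈∂ bd incτ ρ⊆τ len = codim-one-∈∂ (B-increasing (boundary-cell bd)) incτ ρ⊆τ (trans len (cong suc (sym (boundary-length bd))))

  Γ-injective : ∀ {τ} → Cell τ → length τ ≡ suc (suc d′) → ∀ u v → u ∈ τ → v ∈ τ → Γ u ≡ Γ v → u ≡ v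
  Γ-injective {τ} = hΓ τ

  derived∈δ : ∀ {m ρ s τ} → Boundary m ρ → Derivation s τ → ρ ⊆ τ → δ T ⟨ ρ ⟩ ⟨ τ ⟩
  derived∈δ {s = s} bd dc ρ⊆τ = (s , derivation-cell dc) , boundary∈∂ bd (derivation-increasing dc) ρ⊆τ (derivation-length dc)

  attach-label : ∀ {m ρ s τ} j (bd : Boundary m ρ) → Derivation s τ → ρ ⊆ τ →
                 Σ (Fin (suc k′)) λ β → Ω ⟨ ρ ⟩ β ⟨ τ ⟩ ≡ ⟨ child m ρ j ⟩
  attach-label {m} {ρ} j bd dc ρ⊆τ =
    Ω-transitive ⟨ ρ ⟩ ((m , boundary-cell bd) , boundary-length bd) _ _ (derived∈δ bd dc ρ⊆τ)
      ((suc m , child-cell j bd) , boundary∈∂ bd (child-increasing j bd) (⊆-child m ρ j) (child-length j bd))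

  module Cofaces {ρ : List ℕ} (bi : Birth ρ) where
    open Birth bi

    cofaces : List (MCell T)
    cofaces = ⟨ parent boundary ⟩ ∷ tabulate (λ j → ⟨ child stage ρ j ⟩)

    length-cofaces : length cofaces ≡ suc k′
    length-cofaces = cong suc (length-tabulate _)

    cofaces-unique : Unique cofaces
    cofaces-unique = All.tabulate parent≢child
                   ∷ Uniqueₚ.tabulate⁺ (λ e → proj₂ (proj₂ (child-injective boundary boundary (⟨⟩-injective e))))
      where
      parent≢child : ∀ {a} → a ∈ tabulate (λ j → ⟨ child stage ρ j ⟩) → ⟨ parent boundary ⟩ ≢ a
      parent≢child a∈ e with ∈-tabulate⁻ a∈
      ... | j , refl = new-fresh≤ j boundary ≤-refl (parent-cell boundary)
                         (subst (new stage ρ j ∈_) (sym (⟨⟩-injective e)) (new∈child stage ρ j))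

    ρ-dim : IsDimMCell T d′ ⟨ ρ ⟩
    ρ-dim = (stage , boundary-cell boundary) , boundary-length boundary

    parent∈δ : δ T ⟨ ρ ⟩ ⟨ parent boundary ⟩
    parent∈δ = (stage , parent-cell boundary)
             , boundary∈∂ boundary (B-increasing (parent-cell boundary)) (⊆-parent boundary) (parent-length boundary)

    child∈δ : ∀ j → δ T ⟨ ρ ⟩ ⟨ child stage ρ j ⟩
    child∈δ j = (suc stage , child-cell j boundary)
              , boundary∈∂ boundary (child-increasing j boundary) (⊆-child stage ρ j) (child-length j boundary)

    cofaces⊆δ : ∀ a → a ∈ cofaces → δ T ⟨ ρ ⟩ a
    cofaces⊆δ a (here refl) = parent∈δ
    cofaces⊆δ a (there a∈) with ∈-tabulate⁻ a∈
    ... | j , refl = child∈δ j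

    δ-cases : ∀ a → δ T ⟨ ρ ⟩ a → a ≡ ⟨ parent boundary ⟩ ⊎ Σ (Fin k′) λ j → a ≡ ⟨ child stage ρ j ⟩
    δ-cases (mc τ zero) ((n , p) , τ∈∂) with ∈∂⇒⊆ τ∈∂
    ... | ρ⊆τ , len with coface-cases bi p (trans len (cong suc (boundary-length boundary))) ρ⊆τ
    ... | inj₁ e       = inj₁ (cong ⟨_⟩ e)
    ... | inj₂ (j , e) = inj₂ (j , cong ⟨_⟩ e)

    δ⊆cofaces : ∀ a → δ T ⟨ ρ ⟩ a → a ∈ cofaces
    δ⊆cofaces a a∈δ with δ-cases a a∈δ
    ... | inj₁ refl       = here refl
    ... | inj₂ (j , refl) = there (∈-tabulate⁺ j)

    -- A transitive action of C_k on the k cofaces of ρ is free.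
    Ω-free : ∀ a → δ T ⟨ ρ ⟩ a → ∀ β β′ → Ω ⟨ ρ ⟩ β a ≡ Ω ⟨ ρ ⟩ β′ a → β ≡ β′
    Ω-free a a∈δ = onto-injective (λ β → Ω ⟨ ρ ⟩ β a) cofaces cofaces-unique length-cofaces
                     (λ a′ a′∈ → Ω-transitive ⟨ ρ ⟩ ρ-dim a a′ a∈δ (cofaces⊆δ a′ a′∈))
                     (λ β → δ⊆cofaces _ (Ω-maps-to ⟨ ρ ⟩ ρ-dim β a a∈δ))

  ⊆⇒⊑ : ∀ fuel {n σ τ} → length τ ≤ fuel → Increasing σ → B n τ → σ ⊆ τ → _⊑_ T ⟨ σ ⟩ ⟨ τ ⟩
  ⊆⇒⊑ fuel {n} {σ} {τ} l incσ p σ⊆τ with length τ ≤? length σ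
  ... | yes τ≤σ = subst (λ τ′ → _⊑_ T ⟨ σ ⟩ ⟨ τ′ ⟩) (increasing-⊆-length⇒≡ incσ (B-increasing p) σ⊆τ τ≤σ) ⊑-refl
  ... | no τ≰σ with ∃-lookup∉ σ (increasing⇒unique (B-increasing p)) (≰⇒> τ≰σ)
  ... | i , y∉σ = ⊑-trans (via-face fuel l) (⊑-step (i , refl) ⊑-refl)
    where
    σ⊆face : σ ⊆ removeAt τ i
    σ⊆face v v∈ = ∈-removeAt⁺ τ i (σ⊆τ v v∈) (λ e → y∉σ (subst (_∈ σ) e v∈))
    via-face : ∀ fuel → length τ ≤ fuel → _⊑_ T ⟨ σ ⟩ ⟨ removeAt τ i ⟩
    via-face zero       l = ⊥-elim (τ≰σ (≤-trans l z≤n))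
    via-face (suc fuel) l = ⊆⇒⊑ fuel (s≤s⁻¹ (subst (_≤ suc fuel) (length-removeAt′ τ i) l)) incσ
                              (B-face p (AllPairs-removeAt τ i (B-increasing p)) (λ v → ∈-removeAt⁻ τ i)) σ⊆face

  derivation-path : ∀ {s τ} → Derivation s τ → Star (Adjacent T (suc d′)) ⟨ τ ⟩ ⟨ 𝒯 ⟩
  derivation-path initial = ε
  derivation-path (attach {m} {ρ} {s} {τ} j bd dc _ ρ⊆τ) = adjacent ◅ derivation-path dc
    where
    adjacent : Adjacent T (suc d′) ⟨ child m ρ j ⟩ ⟨ τ ⟩
    adjacent = ((suc m , child-cell j bd) , child-length j bd)
             , ((s , derivation-cell dc) , derivation-length dc)
             , ⟨ ρ ⟩ , (m , boundary-cell bd)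
             , boundary∈∂ bd (child-increasing j bd) (⊆-child m ρ j) (child-length j bd)
             , boundary∈∂ bd (derivation-increasing dc) ρ⊆τ (derivation-length dc)

  Adjacent-sym : ∀ {a b} → Adjacent T (suc d′) a b → Adjacent T (suc d′) b a
  Adjacent-sym (a-dim , b-dim , c , c-cell , c∈∂a , c∈∂b) = b-dim , a-dim , c , c-cell , c∈∂b , c∈∂a

  T-isObj : IsObj (TObj A Γ Ω)
  T-isObj = record
    { multicomplex = record
        { cell-strict   = λ (_ , p) → increasing⇒strict (B-increasing p)
        ; cell-nonempty = 𝒯 , 0 , 𝒯∈B₀
        ; cell-closed   = λ (n , p) st σ⊆τ → n , B-face p (strict⇒increasing st) σ⊆τ
        ; dim-le        = λ (_ , p) → B-dim≤ p
        ; dim-attained  = 𝒯 , (0 , 𝒯∈B₀) , 𝒯-dim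
        ; m-low         = λ _ _ → refl
        ; consistent    = λ _ _ _ _ _ _ _ _ _ _ e → cong ⟨_⟩ e
        }
    ; pure       = pure
    ; colorable  = Γ , hΓ
    ; connected  = connected
    ; degree     = degree
    ; coloring   = hΓ
    ; ordering   = hΩ
    ; base       = (0 , 𝒯∈B₀) , 𝒯-dim
    }
    where
    pure : Pure T (suc d′)
    pure (mc σ zero) (n , p) with home-of p
    ... | home s τ dc σ⊆τ = ⟨ τ ⟩ , ((s , derivation-cell dc) , derivation-length dc)
                          , ⊆⇒⊑ (length τ) ≤-refl (B-increasing p) (derivation-cell dc) σ⊆τ
    connected : LowerPathConnected T (suc d′)
    connected (mc τ zero) (mc τ′ zero) ((_ , p) , len) ((_ , p′) , len′) with derive p len | derive p′ len′
    ... | _ , dc , _ | _ , dc′ , _ = derivation-path dc ◅◅ reverse (λ {a} {b} → Adjacent-sym {a} {b}) (derivation-path dc′)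
    degree : DegBound T (suc d′) (suc k′)
    degree (mc ρ zero) ((_ , p) , len) = cofaces , cofaces-unique , ≤-reflexive length-cofaces
                                       , λ a → cofaces⊆δ a , δ⊆cofaces a
      where
      open Cofaces (birth p len)

  module Target (O : PreObj (suc d′) (suc k′)) (hO : IsObj O) where
    open PreObj O renaming (X to Y; γ to γ̂; ω to ω̂; a₀ to â₀)
    open IsObj hO renaming (base to â₀-dim)
    open IsKOrdering ordering using () renaming (maps-to to ω̂-maps-to; hom to ω̂-hom)
    open Restriction O hO

    -- The canonical morphism

    hasColourIn : List ℕ → ℕ → Bool
    hasColourIn σ v = does (any? (λ u → γ̂ v Fin.≟ Γ u) σ)

    hasColourIn⁻ : ∀ σ v → hasColourIn σ v ≡ true → Σ ℕ λ u → u ∈ σ × γ̂ v ≡ Γ u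
    hasColourIn⁻ σ v e with any? (λ u → γ̂ v Fin.≟ Γ u) σ
    ... | yes p = find p
    hasColourIn⁻ σ v () | no _

    hasColourIn⁺ : ∀ σ v {u} → u ∈ σ → γ̂ v ≡ Γ u → hasColourIn σ v ≡ true
    hasColourIn⁺ σ v u∈ e with any? (λ u → γ̂ v Fin.≟ Γ u) σ
    ... | yes _ = refl
    ... | no ¬p = ⊥-elim (¬p (lose u∈ e))

    hasColourIn-mono : ∀ {σ σ′} v → σ ⊆ σ′ → hasColourIn σ v ≡ true → hasColourIn σ′ v ≡ true
    hasColourIn-mono {σ} {σ′} v σ⊆σ′ e with hasColourIn⁻ σ v e
    ... | u , u∈ , c = hasColourIn⁺ σ′ v (σ⊆σ′ u u∈) c

    hasColourIn-false : ∀ σ v → (∀ u → u ∈ σ → γ̂ v ≢ Γ u) → hasColourIn σ v ≡ false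
    hasColourIn-false σ v absent with any? (λ u → γ̂ v Fin.≟ Γ u) σ
    ... | yes p = let (u , u∈ , e) = find p in ⊥-elim (absent u u∈ e)
    ... | no _  = refl

    _⇂_ : MCell Y → List ℕ → MCell Y
    a ⇂ σ = a ↾ hasColourIn σ

    DimY : MCell Y → Set
    DimY = IsDimMCell Y (suc d′)

    module _ {a} (a-dim : DimY a) where
      ∈-⇂⁻ : ∀ σ {v} → v ∈ ι (a ⇂ σ) → v ∈ ι a × Σ ℕ λ u → u ∈ σ × γ̂ v ≡ Γ u
      ∈-⇂⁻ σ {v} v∈ = let (v∈a , has) = ∈-↾⁻ (hasColourIn σ) a v∈ in v∈a , hasColourIn⁻ σ v has

      ∈-⇂⁺ : ∀ σ {u} → u ∈ σ → Σ ℕ λ v → v ∈ ι (a ⇂ σ) × γ̂ v ≡ Γ u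
      ∈-⇂⁺ σ {u} u∈ = let (v , v∈ , c) = colour-attained {a} a-dim (Γ u) in
                      v , ∈-↾⁺ (hasColourIn σ) a (proj₁ a-dim) v∈ (hasColourIn⁺ σ v u∈ c) , c

      ⇂-mcell : ∀ σ → IsMCell Y (a ⇂ σ)
      ⇂-mcell σ = ↾-mcell (hasColourIn σ) a (proj₁ a-dim)

      length-⇂ : ∀ {τ σ} → Cell τ → length τ ≡ suc (suc d′) → Increasing σ → σ ⊆ τ → length (ι (a ⇂ σ)) ≡ length σ
      length-⇂ {τ} {σ} τ-cell τ-dim incσ σ⊆τ = ≤-antisym ⇂↪σ σ↪⇂
        where
        ⇂↪σ : length (ι (a ⇂ σ)) ≤ length σ
        ⇂↪σ = length-≤-injection (λ v u → γ̂ v ≡ Γ u) σ (ι-unique {a ⇂ σ} (⇂-mcell σ))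
                (λ v v∈ → proj₂ (∈-⇂⁻ σ v∈))
                (λ v v′ u p q c c′ → colouring-injective {a} a-dim v v′ (proj₁ (∈-⇂⁻ σ p)) (proj₁ (∈-⇂⁻ σ q)) (trans c (sym c′)))
        σ↪⇂ : length σ ≤ length (ι (a ⇂ σ))
        σ↪⇂ = length-≤-injection (λ u v → γ̂ v ≡ Γ u) (ι (a ⇂ σ)) (increasing⇒unique incσ) (λ u u∈ → ∈-⇂⁺ σ u∈)
                (λ u u′ v p q c c′ → Γ-injective τ-cell τ-dim u u′ (σ⊆τ u p) (σ⊆τ u′ q) (trans (sym c) c′))

      ⇂-codim-one : ∀ {τ ρ} → Cell τ → length τ ≡ suc (suc d′) → Increasing ρ → ρ ⊆ τ → length ρ ≡ suc d′ →
                    IsDimMCell Y d′ (a ⇂ ρ) × δ Y (a ⇂ ρ) a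
      ⇂-codim-one {τ} {ρ} τ-cell τ-dim incρ ρ⊆τ ρ-dim = (⇂-mcell ρ , S-dim) , proj₁ a-dim , i , face≡S
        where
        S = a ⇂ ρ
        S-dim : length (ι S) ≡ suc d′
        S-dim = trans (length-⇂ τ-cell τ-dim incρ ρ⊆τ) ρ-dim
        missing = ∃-lookup∉ (ι S) (ι-unique {a} (proj₁ a-dim)) (subst₂ _<_ (sym S-dim) (sym (proj₂ a-dim)) ≤-refl)
        i = proj₁ missing
        S⊆face : ∀ v → v ∈ ι S → v ∈ removeAt (ι a) i
        S⊆face v v∈ = ∈-removeAt⁺ (ι a) i (proj₁ (∈-⇂⁻ ρ v∈)) (λ e → proj₂ missing (subst (_∈ ι S) e v∈))
        ιS≡face : ι S ≡ removeAt (ι a) i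
        ιS≡face = increasing-⊆-length⇒≡ (ι-increasing {S} (⇂-mcell ρ)) (AllPairs-removeAt (ι a) i (ι-increasing {a} (proj₁ a-dim))) S⊆face
                    (≤-reflexive (suc-injective (trans (sym (length-removeAt′ (ι a) i)) (trans (proj₂ a-dim) (cong suc (sym S-dim))))))
        face≡S : face Y a i ≡ S
        face≡S = face≡↾ a i (hasColourIn ρ) (proj₁ a-dim)
                       (hasColourIn-false ρ _ (λ u u∈ c → proj₂ missing (∈-↾⁺ (hasColourIn ρ) a (proj₁ a-dim) (∈-lookup i) (hasColourIn⁺ ρ _ u∈ c))))
                       (λ v v∈ → proj₂ (∈-↾⁻ (hasColourIn ρ) a (subst (v ∈_) (sym ιS≡face) v∈)))

      removed-colour-absent : ∀ b → IsMCell Y b → (∀ v → v ∈ ι b → v ∈ ι a) → ∀ j σ →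
                              (∀ u → u ∈ σ → Σ ℕ λ v → v ∈ removeAt (ι b) j × γ̂ v ≡ Γ u) →
                              hasColourIn σ (lookup (ι b) j) ≡ false
      removed-colour-absent b b-cell b⊆a j σ present = hasColourIn-false σ (lookup (ι b) j) absent
        where
        absent : ∀ u → u ∈ σ → γ̂ (lookup (ι b) j) ≢ Γ u
        absent u u∈ c with present u u∈
        ... | w , w∈ , cw = ∈-removeAt⇒≢lookup (ι b) j (ι-unique {b} b-cell) w∈
                              (sym (colouring-injective {a} a-dim _ w (b⊆a _ (∈-lookup j)) (b⊆a _ (∈-removeAt⁻ (ι b) j w∈))
                                                        (trans c (sym cw))))

      ⇂-⇂ : ∀ {σ σ′} → σ′ ⊆ σ → (a ⇂ σ) ⇂ σ′ ≡ a ⇂ σ′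
      ⇂-⇂ {σ} {σ′} σ′⊆σ =
        trans (↾-↾ a (hasColourIn σ) (hasColourIn σ′) (proj₁ a-dim))
              (↾-cong _ (hasColourIn σ′) a (λ v _ → ≡true-ext (λ t → proj₂ (∧≡true⁻ t)) (λ t → ∧≡true⁺ (hasColourIn-mono v σ′⊆σ t) t)))

    -- The image of a derived d-cell: follow its derivation in Y, reflecting across the face with the
    -- colours of the boundary cell by the same element of C_k.
    image : ∀ {s τ} → Derivation s τ → MCell Y
    image initial                        = â₀
    image (attach {ρ = ρ} j bd dc _ ρ⊆τ) = ω̂ (image dc ⇂ ρ) (proj₁ (attach-label j bd dc ρ⊆τ)) (image dc)

    mutual
      image-dim : ∀ {s τ} (dc : Derivation s τ) → DimY (image dc)
      image-dim initial = â₀-dim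
      image-dim (attach j bd dc _ ρ⊆τ) =
        coface-dim (proj₁ (boundary-image bd dc ρ⊆τ))
          (ω̂-maps-to _ (proj₁ (boundary-image bd dc ρ⊆τ)) _ (image dc) (proj₂ (boundary-image bd dc ρ⊆τ)))

      boundary-image : ∀ {m ρ s τ} → Boundary m ρ → (dc : Derivation s τ) → ρ ⊆ τ →
                       IsDimMCell Y d′ (image dc ⇂ ρ) × δ Y (image dc ⇂ ρ) (image dc)
      boundary-image {s = s} bd dc ρ⊆τ =
        ⇂-codim-one (image-dim dc) (s , derivation-cell dc) (derivation-length dc) (B-increasing (boundary-cell bd)) ρ⊆τ (boundary-length bd)

    image-attach-⇂ : ∀ {m ρ s τ} j (bd : Boundary m ρ) (dc : Derivation s τ) (s≤m : s ≤ m) (ρ⊆τ : ρ ⊆ τ) σ → σ ⊆ ρ →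
                     image (attach j bd dc s≤m ρ⊆τ) ⇂ σ ≡ image dc ⇂ σ
    image-attach-⇂ {ρ = ρ} j bd dc s≤m ρ⊆τ σ σ⊆ρ =
      begin
        a′ ⇂ σ          ≡⟨ ↾-face a′ i (hasColourIn σ) (proj₁ a′-dim) removed-absent ⟨
        face Y a′ i ⇂ σ ≡⟨ cong (_⇂ σ) face≡S ⟩
        (a ⇂ ρ) ⇂ σ     ≡⟨ ⇂-⇂ a-dim σ⊆ρ ⟩
        a ⇂ σ           ∎
      where
      open ≡-Reasoning
      a = image dc
      a-dim = image-dim dc
      a′ = image (attach j bd dc s≤m ρ⊆τ)
      a′-dim = image-dim (attach j bd dc s≤m ρ⊆τ)
      S-is-face = boundary-image bd dc ρ⊆τ
      a′∈δS = ω̂-maps-to _ (proj₁ S-is-face) _ a (proj₂ S-is-face)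
      i = proj₁ (proj₂ a′∈δS)
      face≡S : face Y a′ i ≡ a ⇂ ρ
      face≡S = proj₂ (proj₂ a′∈δS)
      removed-absent : hasColourIn σ (lookup (ι a′) i) ≡ false
      removed-absent = removed-colour-absent {a′} a′-dim a′ (proj₁ a′-dim) (λ _ v∈ → v∈) i σ λ u u∈ →
        let (v , v∈ , c) = ∈-⇂⁺ a-dim ρ (σ⊆ρ u u∈) in v , subst (v ∈_) (cong ι (sym face≡S)) v∈ , c

    image-unique : ∀ {s₁ τ₁ s₂ τ₂} (dc₁ : Derivation s₁ τ₁) (dc₂ : Derivation s₂ τ₂) → τ₁ ≡ τ₂ → image dc₁ ≡ image dc₂
    image-unique initial initial _ = refl
    image-unique initial (attach j bd _ _ _) e = ⊥-elim (𝒯≢child j bd e)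
    image-unique (attach j bd _ _ _) initial e = ⊥-elim (𝒯≢child j bd (sym e))
    image-unique (attach {ρ = ρ} j bd dc s≤m ρ⊆τ) (attach j₂ bd₂ dc₂ s₂≤m ρ⊆τ₂) e with child-injective bd bd₂ e
    ... | refl , refl , refl = cong₂ (λ a β → ω̂ (a ⇂ ρ) β a) (image-unique dc dc₂ parents≡) labels≡
      where
      open Cofaces (birth (boundary-cell bd) (boundary-length bd))
      parents≡ = trans (derived-parent bd dc s≤m ρ⊆τ) (sym (derived-parent bd dc₂ s₂≤m ρ⊆τ₂))
      label₁ = attach-label j bd dc ρ⊆τ
      label₂ = attach-label j bd₂ dc₂ ρ⊆τ₂
      labels≡ : proj₁ label₁ ≡ proj₁ label₂
      labels≡ = Ω-free _ (derived∈δ bd dc ρ⊆τ) _ _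
                  (trans (proj₂ label₁) (trans (sym (proj₂ label₂)) (cong (λ τ → Ω ⟨ ρ ⟩ (proj₁ label₂) ⟨ τ ⟩) (sym parents≡))))

    -- The d-cells containing σ form a subtree of the tree of derivations; along it the images agree on σ.
    image-⇂-agree≤ : ∀ {s₁ τ₁ s₂ τ₂} (dc₁ : Derivation s₁ τ₁) (dc₂ : Derivation s₂ τ₂) σ → σ ⊆ τ₁ → σ ⊆ τ₂ → s₂ ≤ s₁ →
                     image dc₁ ⇂ σ ≡ image dc₂ ⇂ σ
    image-⇂-agree≤ initial initial σ _ _ _ = refl
    image-⇂-agree≤ initial (attach _ _ _ _ _) σ _ _ ()
    image-⇂-agree≤ dc₁@(attach {m} {ρ} {s} j bd dc s≤m ρ⊆τ) dc₂ σ σ⊆τ₁ σ⊆τ₂ s₂≤ with new m ρ j ∈? σ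
    ... | yes new∈ = cong (_⇂ σ) (image-unique dc₁ dc₂ (sym (derived∋new≡child j bd dc₂ s₂≤ (σ⊆τ₂ _ new∈))))
    ... | no new∉ = trans (image-attach-⇂ j bd dc s≤m ρ⊆τ σ σ⊆ρ) via-parent
      where
      σ⊆ρ = ⊆child⇒⊆boundary j σ σ⊆τ₁ new∉
      σ⊆τ : σ ⊆ _
      σ⊆τ v v∈ = ρ⊆τ v (σ⊆ρ v v∈)
      via-parent : image dc ⇂ σ ≡ image dc₂ ⇂ σ
      via-parent with _ ≤? s
      ... | yes s₂≤s = image-⇂-agree≤ dc dc₂ σ σ⊆τ σ⊆τ₂ s₂≤s
      ... | no s₂≰s  = sym (image-⇂-agree≤ dc₂ dc σ σ⊆τ₂ σ⊆τ (≰⇒≥ s₂≰s))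

    image-⇂-agree : ∀ {s₁ τ₁ s₂ τ₂} (dc₁ : Derivation s₁ τ₁) (dc₂ : Derivation s₂ τ₂) σ → σ ⊆ τ₁ → σ ⊆ τ₂ →
                    image dc₁ ⇂ σ ≡ image dc₂ ⇂ σ
    image-⇂-agree {s₁} {s₂ = s₂} dc₁ dc₂ σ σ⊆τ₁ σ⊆τ₂ with s₂ ≤? s₁
    ... | yes s₂≤s₁ = image-⇂-agree≤ dc₁ dc₂ σ σ⊆τ₁ σ⊆τ₂ s₂≤s₁
    ... | no s₂≰s₁  = sym (image-⇂-agree≤ dc₂ dc₁ σ σ⊆τ₂ σ⊆τ₁ (≰⇒≥ s₂≰s₁))

    image⇂top : ∀ {s τ} (dc : Derivation s τ) → image dc ⇂ τ ≡ image dc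
    image⇂top {s} {τ} dc = ↾-all (hasColourIn τ) (image dc) all-present
      where
      all-present : ∀ v → v ∈ ι (image dc) → hasColourIn τ v ≡ true
      all-present v v∈ with injection-onto-Fin Γ τ (increasing⇒unique (derivation-increasing dc)) (derivation-length dc)
                              (Γ-injective (s , derivation-cell dc) (derivation-length dc)) (γ̂ v)
      ... | u , u∈ , c = hasColourIn⁺ τ v u∈ (sym c)

    home-cell : ∀ {σ} → Cell σ → Home σ
    home-cell (_ , p) = home-of p

    open Home using (derivation; ⊆-top)

    Γ-injective-cell : ∀ {σ} → Cell σ → ∀ u v → u ∈ σ → v ∈ σ → Γ u ≡ Γ v → u ≡ v
    Γ-injective-cell c u v u∈ v∈ =
      Γ-injective (_ , derivation-cell dc) (derivation-length dc) u v (⊆-top (home-cell c) u u∈) (⊆-top (home-cell c) v v∈)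
      where
      dc = derivation (home-cell c)

    φ̃ : (a : MCell T) → IsMCell T a → MCell Y
    φ̃ a c = image (derivation (home-cell c)) ⇂ ι a

    φ̃-agrees : ∀ a c {s τ} (dc : Derivation s τ) → ι a ⊆ τ → φ̃ a c ≡ image dc ⇂ ι a
    φ̃-agrees a c dc ι⊆τ = image-⇂-agree (derivation (home-cell c)) dc (ι a) (⊆-top (home-cell c)) ι⊆τ

    φ̃-mcell : ∀ a c → IsMCell Y (φ̃ a c)
    φ̃-mcell a c = ⇂-mcell (image-dim (derivation (home-cell c))) (ι a)

    φ₀ : (v : ℕ) → Cell (v ∷ []) → ℕ
    φ₀ v c = proj₁ (colour-attained {image (derivation (home-cell c))} (image-dim (derivation (home-cell c))) (Γ v))

    φ₀-image : ∀ v c {s τ} (dc : Derivation s τ) → v ∈ τ → φ₀ v c ∈ ι (image dc) × γ̂ (φ₀ v c) ≡ Γ v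
    φ₀-image v c dc v∈τ = proj₁ (∈-⇂⁻ (image-dim dc) (v ∷ []) (subst (λ b → φ₀ v c ∈ ι b) agree ∈home)) , colour
      where
      a = image (derivation (home-cell c))
      attained = colour-attained {a} (image-dim (derivation (home-cell c))) (Γ v)
      colour = proj₂ (proj₂ attained)
      ∈home : φ₀ v c ∈ ι (a ⇂ (v ∷ []))
      ∈home = ∈-↾⁺ (hasColourIn (v ∷ [])) a (proj₁ (image-dim (derivation (home-cell c)))) (proj₁ (proj₂ attained))
                    (hasColourIn⁺ (v ∷ []) _ (here refl) colour)
      agree = image-⇂-agree (derivation (home-cell c)) dc (v ∷ []) (⊆-top (home-cell c)) (λ { _ (here refl) → v∈τ })

    φ₀-irrelevant : ∀ v c c′ → φ₀ v c ≡ φ₀ v c′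
    φ₀-irrelevant v c c′ =
      colouring-injective {image dc} (image-dim dc) _ _ (proj₁ (φ₀-image v c dc v∈)) (proj₁ (φ₀-image v c′ dc v∈))
        (trans (proj₂ (φ₀-image v c dc v∈)) (sym (proj₂ (φ₀-image v c′ dc v∈))))
      where
      dc = derivation (home-cell c)
      v∈ = ⊆-top (home-cell c) v (here refl)

    vertex-cell : ∀ {σ v} → Cell σ → v ∈ σ → Cell (v ∷ [])
    vertex-cell (n , p) v∈ = n , B-face p ([] ∷ []) (λ { _ (here refl) → v∈ })

    φ̃-over : ∀ a c w → w ∈ ι (φ̃ a c) ⇔ (∃[ v ] (v ∈ ι a × Σ (Cell (v ∷ [])) λ c′ → φ₀ v c′ ≡ w))
    φ̃-over a c w = to , from
      where
      dc = derivation (home-cell c)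
      a-dim = image-dim dc
      φ₀-image-home : ∀ {u} (u∈ : u ∈ ι a) c′ → φ₀ u c′ ∈ ι (image dc) × γ̂ (φ₀ u c′) ≡ Γ u
      φ₀-image-home u∈ c′ = φ₀-image _ c′ dc (⊆-top (home-cell c) _ u∈)
      to : w ∈ ι (φ̃ a c) → ∃[ v ] (v ∈ ι a × Σ (Cell (v ∷ [])) λ c′ → φ₀ v c′ ≡ w)
      to w∈ with ∈-⇂⁻ a-dim (ι a) w∈
      ... | w∈a , u , u∈ , cw = u , u∈ , c′ , colouring-injective {image dc} a-dim _ _ (proj₁ image-u) w∈a (trans (proj₂ image-u) (sym cw))
        where
        c′ = vertex-cell c u∈
        image-u = φ₀-image-home u∈ c′
      from : (∃[ v ] (v ∈ ι a × Σ (Cell (v ∷ [])) λ c′ → φ₀ v c′ ≡ w)) → w ∈ ι (φ̃ a c)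
      from (u , u∈ , c′ , refl) = ∈-↾⁺ (hasColourIn (ι a)) (image dc) (proj₁ a-dim) (proj₁ image-u) (hasColourIn⁺ (ι a) _ u∈ (proj₂ image-u))
        where
        image-u = φ₀-image-home u∈ c′

    φ̃-colour : ∀ a c x → Colors Y γ̂ (φ̃ a c) x ⇔ Colors T Γ a x
    φ̃-colour a c x = to , from
      where
      a-dim = image-dim (derivation (home-cell c))
      to : Colors Y γ̂ (φ̃ a c) x → Colors T Γ a x
      to (w , w∈ , e) with ∈-⇂⁻ a-dim (ι a) w∈
      ... | _ , u , u∈ , cw = u , u∈ , trans (sym cw) e
      from : Colors T Γ a x → Colors Y γ̂ (φ̃ a c) x
      from (u , u∈ , e) with ∈-⇂⁺ a-dim (ι a) u∈
      ... | v , v∈ , cv = v , v∈ , trans cv e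

    φ̃-glue : ∀ a c i c′ j → removeAt (ι (φ̃ a c)) j ≡ ι (φ̃ (face T a i) c′) → face Y (φ̃ a c) j ≡ φ̃ (face T a i) c′
    φ̃-glue a c i c′ j e =
      begin
        face Y S j                 ≡⟨ face≡↾ S j (hasColourIn σ′) S-cell removed-absent rest-present ⟩
        (image dc ⇂ ι a) ⇂ σ′      ≡⟨ ⇂-⇂ a-dim (λ v → ∈-removeAt⁻ (ι a) i) ⟩
        image dc ⇂ σ′              ≡⟨ φ̃-face ⟨
        φ̃ (face T a i) c′          ∎
      where
      open ≡-Reasoning
      dc = derivation (home-cell c)
      a-dim = image-dim dc
      S = φ̃ a c
      S-cell = φ̃-mcell a c
      σ′ = removeAt (ι a) i
      φ̃-face : φ̃ (face T a i) c′ ≡ image dc ⇂ σ′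
      φ̃-face = φ̃-agrees (face T a i) c′ dc (λ v v∈ → ⊆-top (home-cell c) v (∈-removeAt⁻ (ι a) i v∈))
      rest≡ : removeAt (ι S) j ≡ ι (image dc ⇂ σ′)
      rest≡ = trans e (cong ι φ̃-face)
      removed-absent : hasColourIn σ′ (lookup (ι S) j) ≡ false
      removed-absent = removed-colour-absent {image dc} a-dim S S-cell (λ _ v∈ → proj₁ (∈-⇂⁻ a-dim (ι a) v∈)) j σ′ λ u u∈ →
        let (v , v∈ , cv) = ∈-⇂⁺ a-dim σ′ u∈ in v , subst (v ∈_) (sym rest≡) v∈ , cv
      rest-present : ∀ v → v ∈ ι (face Y S j) → hasColourIn σ′ v ≡ true
      rest-present v v∈ = proj₂ (∈-↾⁻ (hasColourIn σ′) (image dc) (subst (v ∈_) rest≡ v∈))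

    module _ {ρ} (bi : Birth ρ) where
      open Birth bi
      open Cofaces bi

      private
        a = image parent-derived
        S = a ⇂ ρ
        S-face = boundary-image boundary parent-derived (⊆-parent boundary)

      image-of-parent : ∀ c → φ̃ ⟨ parent boundary ⟩ c ≡ a
      image-of-parent c = trans (φ̃-agrees ⟨ parent boundary ⟩ c parent-derived (λ _ v∈ → v∈)) (image⇂top parent-derived)

      φ̃-orbit : ∀ β a′ c′ → Ω ⟨ ρ ⟩ β ⟨ parent boundary ⟩ ≡ a′ → φ̃ a′ c′ ≡ ω̂ S β a
      φ̃-orbit β a′ c′ e with δ-cases a′ (subst (δ T ⟨ ρ ⟩) e (Ω-maps-to ⟨ ρ ⟩ ρ-dim β _ parent∈δ))
      ... | inj₁ refl = trans (image-of-parent c′) (sym (trans (cong (λ β′ → ω̂ S β′ a) β≡0)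
                                                                (ordering-identity ordering S (proj₁ S-face) a (proj₂ S-face))))
        where
        β≡0 : β ≡ zero
        β≡0 = Ω-free _ parent∈δ β zero (trans e (sym (ordering-identity hΩ ⟨ ρ ⟩ ρ-dim _ parent∈δ)))
      ... | inj₂ (j , refl) = trans (trans (φ̃-agrees ⟨ child stage ρ j ⟩ c′ child-derived (λ _ v∈ → v∈)) (image⇂top child-derived))
                                    (cong (λ β′ → ω̂ S β′ a) label≡β)
        where
        child-derived = attach j boundary parent-derived parent-stage≤ (⊆-parent boundary)
        label = attach-label j boundary parent-derived (⊆-parent boundary)
        label≡β : proj₁ label ≡ β
        label≡β = Ω-free _ parent∈δ (proj₁ label) β (trans (proj₂ label) (sym e))

    φ̃-order : ∀ b (c-b : IsMCell T b) → length (ι b) ≡ suc d′ → ∀ a (c-a : IsMCell T a) → _∈∂_ T b a →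
              ∀ β (c : IsMCell T (Ω b β a)) → φ̃ (Ω b β a) c ≡ ω̂ (φ̃ b c-b) β (φ̃ a c-a)
    φ̃-order (mc ρ zero) c-ρ ρ-len a c-a ρ∈∂a β c =
      begin
        φ̃ (Ω ⟨ ρ ⟩ β a) c                  ≡⟨ φ̃-orbit bi (β ⊕ βa) _ c Ω-composite ⟩
        ω̂ S (β ⊕ βa) (image parent-derived) ≡⟨ ω̂-hom S (proj₁ S-face) β βa _ (proj₂ S-face) ⟩
        ω̂ S β (ω̂ S βa (image parent-derived)) ≡⟨ cong₂ (λ S′ a′ → ω̂ S′ β a′) φ̃-ρ (φ̃-orbit bi βa a c-a a-in-orbit) ⟨
        ω̂ (φ̃ ⟨ ρ ⟩ c-ρ) β (φ̃ a c-a)         ∎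
      where
      open ≡-Reasoning
      bi = birth (proj₂ c-ρ) ρ-len
      open Birth bi
      open Cofaces bi
      S = image parent-derived ⇂ ρ
      S-face = boundary-image boundary parent-derived (⊆-parent boundary)
      φ̃-ρ : φ̃ ⟨ ρ ⟩ c-ρ ≡ S
      φ̃-ρ = φ̃-agrees ⟨ ρ ⟩ c-ρ parent-derived (⊆-parent boundary)
      orbit = Ω-transitive ⟨ ρ ⟩ ρ-dim _ a parent∈δ (c-a , ρ∈∂a)
      βa = proj₁ orbit
      a-in-orbit : Ω ⟨ ρ ⟩ βa ⟨ parent boundary ⟩ ≡ a
      a-in-orbit = proj₂ orbit
      Ω-composite : Ω ⟨ ρ ⟩ (β ⊕ βa) ⟨ parent boundary ⟩ ≡ Ω ⟨ ρ ⟩ β a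
      Ω-composite = trans (Ω-hom ⟨ ρ ⟩ ρ-dim β βa _ parent∈δ) (cong (Ω ⟨ ρ ⟩ β) a-in-orbit)

    canonical : Morphism (TObj A Γ Ω) O
    canonical = record
      { φ₀      = φ₀
      ; φ₀-irr  = φ₀-irrelevant
      ; φ₀-simp = λ σ c → ι (φ̃ ⟨ σ ⟩ c) , φ̃-mcell ⟨ σ ⟩ c , φ̃-over ⟨ σ ⟩ c
      ; φ       = φ̃
      ; φ-mcell = φ̃-mcell
      ; φ-over  = φ̃-over
      ; φ-glue  = φ̃-glue
      ; φ-base  = λ c → trans (φ̃-agrees ⟨ 𝒯 ⟩ c initial (λ _ v∈ → v∈)) (image⇂top initial)
      ; φ-color = φ̃-colour
      ; φ-order = φ̃-order
      }

    -- Uniqueness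

    module _ (M : Morphism (TObj A Γ Ω) O) where
      open Morphism M using () renaming (φ₀ to ψ₀; φ₀-irr to ψ₀-irr; φ to ψ; φ-mcell to ψ-mcell; φ-over to ψ-over;
                                         φ-glue to ψ-glue; φ-base to ψ-base; φ-color to ψ-colour; φ-order to ψ-order)

      ψ₀∈ : ∀ a c {v} → v ∈ ι a → (c′ : Cell (v ∷ [])) → ψ₀ v c′ ∈ ι (ψ a c)
      ψ₀∈ a c {v} v∈ c′ = proj₂ (ψ-over a c (ψ₀ v c′)) (v , v∈ , c′ , refl)

      ψ₀-colour : ∀ v c → γ̂ (ψ₀ v c) ≡ Γ v
      ψ₀-colour v c with proj₁ (ψ-colour ⟨ v ∷ [] ⟩ c (γ̂ (ψ₀ v c))) (ψ₀ v c , ψ₀∈ ⟨ v ∷ [] ⟩ c (here refl) c , refl)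
      ... | _ , here refl , e = sym e

      ψ-subst : ∀ {a a′} (e : a ≡ a′) (c : IsMCell T a′) → ψ a′ c ≡ ψ a (subst (IsMCell T) (sym e) c)
      ψ-subst refl c = refl

      ψ-face : ∀ {τ} (cτ : Cell τ) i (c′ : Cell (removeAt τ i)) →
               Σ (Fin (length (ι (ψ ⟨ τ ⟩ cτ)))) λ j →
                 γ̂ (lookup (ι (ψ ⟨ τ ⟩ cτ)) j) ≡ Γ (lookup τ i) × face Y (ψ ⟨ τ ⟩ cτ) j ≡ ψ ⟨ removeAt τ i ⟩ c′
      ψ-face {τ} cτ i c′ = j , trans (cong γ̂ (sym (lookup-index y′∈))) (ψ₀-colour y cy)
                             , ψ-glue ⟨ τ ⟩ cτ i c′ j rest≡
        where
        a = ψ ⟨ τ ⟩ cτ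
        y = lookup τ i
        cy = vertex-cell cτ (∈-lookup i)
        y′∈ = ψ₀∈ ⟨ τ ⟩ cτ (∈-lookup i) cy
        j = Any.index y′∈
        τ-unique = increasing⇒unique (B-increasing (proj₂ cτ))
        rest⊆ : ∀ v → v ∈ removeAt (ι a) j → v ∈ ι (ψ ⟨ removeAt τ i ⟩ c′)
        rest⊆ v v∈ with proj₁ (ψ-over ⟨ τ ⟩ cτ v) (∈-removeAt⁻ (ι a) j v∈)
        ... | u , u∈ , cu , refl = ψ₀∈ _ c′ (∈-removeAt⁺ τ i u∈ u≢y) cu
          where
          u≢y : u ≢ y
          u≢y refl = ∈-removeAt⇒≢lookup (ι a) j (ι-unique {a} (ψ-mcell _ cτ)) v∈ (trans (ψ₀-irr y cu cy) (lookup-index y′∈))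
        rest⊇ : ∀ v → v ∈ ι (ψ ⟨ removeAt τ i ⟩ c′) → v ∈ removeAt (ι a) j
        rest⊇ v v∈ with proj₁ (ψ-over _ c′ v) v∈
        ... | u , u∈ , cu , refl = ∈-removeAt⁺ (ι a) j (ψ₀∈ ⟨ τ ⟩ cτ (∈-removeAt⁻ τ i u∈) cu) ψ₀u≢
          where
          ψ₀u≢ : ψ₀ u cu ≢ lookup (ι a) j
          ψ₀u≢ e = ∈-removeAt⇒≢lookup τ i τ-unique u∈
                     (Γ-injective-cell cτ u y (∈-removeAt⁻ τ i u∈) (∈-lookup i)
                       (trans (sym (ψ₀-colour u cu)) (trans (cong γ̂ (trans e (sym (lookup-index y′∈)))) (ψ₀-colour y cy))))
        rest≡ : removeAt (ι a) j ≡ ι (ψ ⟨ removeAt τ i ⟩ c′)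
        rest≡ = increasing-ext (AllPairs-removeAt (ι a) j (ι-increasing {a} (ψ-mcell _ cτ)))
                               (ι-increasing {ψ _ c′} (ψ-mcell _ c′)) rest⊆ rest⊇

      ψ-⇂ : ∀ fuel {σ τ} → length τ ≤ fuel → Increasing σ → σ ⊆ τ → length σ < length τ →
            (cσ : Cell σ) (cτ : Cell τ) → ψ ⟨ σ ⟩ cσ ≡ ψ ⟨ τ ⟩ cτ ⇂ σ
      ψ-⇂ zero {τ = τ} l _ _ σ<τ _ _ = ⊥-elim (<-irrefl refl (<-≤-trans (≤-<-trans z≤n σ<τ) l))
      ψ-⇂ (suc fuel) {σ} {τ} l incσ σ⊆τ σ<τ cσ cτ@(n , p)
        with ∃-lookup∉ σ (increasing⇒unique (B-increasing p)) σ<τ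
      ... | i , y∉σ = by-size (length σ <? length τ′)
        where
        a = ψ ⟨ τ ⟩ cτ
        τ′ = removeAt τ i
        cτ′ : Cell τ′
        cτ′ = n , B-face p (AllPairs-removeAt τ i (B-increasing p)) (λ v → ∈-removeAt⁻ τ i)
        σ⊆τ′ : σ ⊆ τ′
        σ⊆τ′ v v∈ = ∈-removeAt⁺ τ i (σ⊆τ v v∈) (λ e → y∉σ (subst (_∈ σ) e v∈))
        removed-absent : ∀ {j} → γ̂ (lookup (ι a) j) ≡ Γ (lookup τ i) →
                         ∀ σ′ → σ′ ⊆ τ → lookup τ i ∉ σ′ → hasColourIn σ′ (lookup (ι a) j) ≡ false
        removed-absent colour σ′ σ′⊆τ y∉ = hasColourIn-false σ′ _ λ u u∈ c →
          y∉ (subst (_∈ σ′) (sym (Γ-injective-cell cτ _ u (∈-lookup i) (σ′⊆τ u u∈) (trans (sym colour) c))) u∈)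
        by-size : Dec (length σ < length τ′) → ψ ⟨ σ ⟩ cσ ≡ a ⇂ σ
        by-size (yes σ<τ′) with ψ-face cτ i cτ′
        ... | j , colour , face≡ =
          trans (ψ-⇂ fuel (s≤s⁻¹ (subst (_≤ suc fuel) (length-removeAt′ τ i) l)) incσ σ⊆τ′ σ<τ′ cσ cτ′)
            (trans (cong (_⇂ σ) (sym face≡)) (↾-face a j (hasColourIn σ) (ψ-mcell _ cτ) (removed-absent colour σ σ⊆τ y∉σ)))
        by-size (no σ≮τ′) = at-face σ (increasing-⊆-length⇒≡ incσ (AllPairs-removeAt τ i (B-increasing p)) σ⊆τ′ (≮⇒≥ σ≮τ′)) cσ
          where
          at-face : ∀ σ′ → σ′ ≡ τ′ → (c : Cell σ′) → ψ ⟨ σ′ ⟩ c ≡ a ⇂ σ′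
          at-face .τ′ refl c with ψ-face cτ i c
          ... | j , colour , face≡ = trans (sym face≡) (face≡↾ a j (hasColourIn τ′) (ψ-mcell _ cτ)
                                        (removed-absent colour τ′ (λ v → ∈-removeAt⁻ τ i)
                                                        (λ y∈ → ∈-removeAt⇒≢lookup τ i (increasing⇒unique (B-increasing p)) y∈ refl))
                                        present)
            where
            present : ∀ v → v ∈ ι (face Y a j) → hasColourIn τ′ v ≡ true
            present v v∈ with proj₁ (ψ-over _ c v) (subst (λ b → v ∈ ι b) face≡ v∈)
            ... | u , u∈ , cu , refl = hasColourIn⁺ τ′ _ u∈ (ψ₀-colour u cu)

      ψ-image : ∀ {s τ} (dc : Derivation s τ) c → ψ ⟨ τ ⟩ c ≡ image dc
      ψ-image initial c = ψ-base c
      ψ-image (attach {m} {ρ} {s} {τ} j bd dc _ ρ⊆τ) c =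
        begin
          ψ ⟨ child m ρ j ⟩ c               ≡⟨ ψ-subst (proj₂ label) c ⟩
          ψ (Ω ⟨ ρ ⟩ β ⟨ τ ⟩) _               ≡⟨ ψ-order ⟨ ρ ⟩ cρ (boundary-length bd) ⟨ τ ⟩ cτ ρ∈∂τ β _ ⟩
          ω̂ (ψ ⟨ ρ ⟩ cρ) β (ψ ⟨ τ ⟩ cτ)      ≡⟨ cong (λ S → ω̂ S β (ψ ⟨ τ ⟩ cτ)) ψ-ρ ⟩
          ω̂ (ψ ⟨ τ ⟩ cτ ⇂ ρ) β (ψ ⟨ τ ⟩ cτ)   ≡⟨ cong (λ a → ω̂ (a ⇂ ρ) β a) (ψ-image dc cτ) ⟩
          ω̂ (image dc ⇂ ρ) β (image dc)      ∎
        where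
        open ≡-Reasoning
        label = attach-label j bd dc ρ⊆τ
        β = proj₁ label
        cρ : Cell ρ
        cρ = m , boundary-cell bd
        cτ : Cell τ
        cτ = s , derivation-cell dc
        ρ∈∂τ = boundary∈∂ bd (derivation-increasing dc) ρ⊆τ (derivation-length dc)
        ψ-ρ : ψ ⟨ ρ ⟩ cρ ≡ ψ ⟨ τ ⟩ cτ ⇂ ρ
        ψ-ρ = ψ-⇂ (length τ) ≤-refl (B-increasing (boundary-cell bd)) ρ⊆τ
                   (subst₂ _<_ (sym (boundary-length bd)) (sym (derivation-length dc)) ≤-refl) cρ cτ

      ψ≡φ̃ : ∀ a c → ψ a c ≡ φ̃ a c
      ψ≡φ̃ (mc σ zero) c@(_ , p) with length σ <? length (Home.top (home-cell c))
      ... | yes σ<τ = trans (ψ-⇂ _ ≤-refl (B-increasing p) (⊆-top (home-cell c)) σ<τ c (_ , derivation-cell dc))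
                            (cong (_⇂ σ) (ψ-image dc _))
        where
        dc = derivation (home-cell c)
      ... | no σ≮τ = at-top σ (increasing-⊆-length⇒≡ (B-increasing p) (derivation-increasing dc) (⊆-top (home-cell c)) (≮⇒≥ σ≮τ)) c
        where
        dc = derivation (home-cell c)
        at-top : ∀ σ′ → σ′ ≡ Home.top (home-cell c) → (c′ : Cell σ′) → ψ ⟨ σ′ ⟩ c′ ≡ image dc ⇂ σ′
        at-top ._ refl c′ = trans (ψ-image dc c′) (sym (image⇂top dc))

    unique : ∀ (M M′ : Morphism (TObj A Γ Ω) O) a c c′ → Morphism.φ M a c ≡ Morphism.φ M′ a c′
    unique M M′ a c c′ =
      trans (ψ≡φ̃ M a c) (trans (sym (φ̃-agrees a c′ (derivation (home-cell c)) (⊆-top (home-cell c)))) (sym (ψ≡φ̃ M′ a c′)))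

proposition5p4 : ∀ (d k : ℕ) → 1 ≤ d → 1 ≤ k →
    (A : Arboreal d k) →
    (Γ : ℕ → Fin (suc d)) → IsColoring (TComplex A) d Γ →
    (Ω : MCell (TComplex A) → Fin k → MCell (TComplex A) → MCell (TComplex A)) →
    IsKOrdering (TComplex A) d k Ω →
    IsObj (TObj A Γ Ω) ×
    (∀ (O : PreObj d k) → IsObj O →
      Σ (Morphism (TObj A Γ Ω) O) λ _ →
        ∀ (M M' : Morphism (TObj A Γ Ω) O) a p p' →
          Morphism.φ M a p ≡ Morphism.φ M' a p')
proposition5p4 (suc d′) (suc k′) (s≤s z≤n) (s≤s z≤n) A Γ hΓ Ω hΩ =
  T-isObj , λ O hO → Target.canonical O hO , Target.unique O hO
  where
  open UniversalProperty d′ k′ A Γ hΓ Ω hΩ
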